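{- Let $G$ be a graph, $(G=G_1,\ldots,G_n)$ a contraction sequence of width $d$, $k\in\mathbb N$, $I$ a finite set, and $\psi_\alpha(x_1,\ldots,x_k,y)$ a quantifier-free formula for each $\alpha\in I$. Let $i\in[2,n]$, let $\pi$ be a virtual $i$-profile, let $f'$ be a function compatible with $\pi$, let $\{\pi_j:j\in[m]\}$ be an $f'$-decomposition of $\pi$, and let $\mathbf s^j$ be a solution of $\pi_j$ for each $j\in[m]$. Then $\mathbf s=\bigoplus_{j\in[m]}\mathbf s^j$ is a solution of $\pi$. Moreover, if $\nu_j$ is the value of $\mathbf s^j$ for each $j\in[m]$, then the value of $\mathbf s$ is $\sum_{j\in[m]}\nu_j$.
   Context: Graphs are finite, simple, undirected; formulas are over the vocabulary $\{=,E\}$ of graphs. A trigraph has edges partitioned into black edges $B(\cdot)$ and red edges $R(\cdot)$; ordinary graphs have no red edges. Contracting distinct vertices $u,v$ of a trigraph deletes $u,v$ and adds a new vertex $w$ with a black edge $wx$ for each $x$ with $xu,xv$ both black, and a red edge $wy$ for each $y$ with $yu$ or $yv$ red, or with $y$ black-adjacent to exactly one of $u,v$ and non-adjacent to the other. A contraction sequence $(G=G_1,\ldots,G_n)$ has $|V(G_n)|=1$ and each $G_{i+1}$ obtained from $G_i$ by one contraction; its width is the maximum red degree over all $G_i$. Bags: $\beta(u)=\{u\}$ for $u\in V(G)$, $\beta(w)=\beta(u)\cup\beta(v)$ if $w$ arises by contracting $u,v$; $\beta(X)=\bigcup_{u\in X}\beta(u)$. A basic $i$-profile is $(T,D)$ with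 $T\subseteq V(G_i)$, $|T|\le k(d+1)$, $T$ connected via red edges of $G_i$, $D\subseteq T$, $|D|\le k$. Virtual profiles: a virtual $i$-profile is $\pi=(T,D,\mathcal V,\mathcal E,f,H)$ where $(T,D)$ is a basic $i$-profile; $\mathcal V$ is a set of at most $k$ virtual vertices (new objects disjoint from all vertices of $G$ and the $G_j$); $\mathcal E\subseteq\{uv:u\in\mathcal V\cup T,v\in\mathcal V\}$; $f:[k]\to D\cup\mathcal V$ is surjective with $|f^{ -1}(u)|\le|\beta(u)|$ for $u\in D$; $H$ is a graph with at most $k$ vertices labeled as $\{h_1,\ldots,h_k\}$ (each vertex is $h_a$ for at least one $a$; the vertices of $H$ are likewise new objects). The expanded graph $G_\pi$ has vertex set $\beta(T)\cup\mathcal V$ and edge set $E(G[\beta(T)])\cup\{uv\in\mathcal E:u,v\in\mathcal V\}\cup\{u_0v: uv\in\mathcal E, v\in\mathcal V, u\in T, u_0\in\beta(u)\}$. A tuple $\mathbf s=(s_1,\ldots,s_k)\in V(G_\pi)^k$ is a solution of $\pi$ if for each $a\in[k]$, $s_a=f(a)$ when $f(a)\in\mathcal V$ and $s_a\in\beta(f(a))$ when $f(a)\in D$, and the map $s_a\mapsto h_a$ is a well-defined isomorphism from $G_\pi[\{s_1,\ldots,s_k\}]$ to $H$. Its value is $\sum_{\alpha\in I}|\{u\in\beta(T):G_\pi\models\psi_\alpha(s_1,\ldots,s_k,u)\}|$. Decompositions: let $\{v\}=V(G_i)\setminus V(G_{i-1})$, $\{u_1,u_2\}=V(G_{i-1})\setminus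 V(G_i)$, $\pi=(T,D,\mathcal V,\mathcal E,f,H)$ with $v\in T$ (if $v\notin T$ no decomposition is considered), $T'=(T\setminus\{v\})\cup\{u_1,u_2\}$, and $\mathcal E'=\{uw\in\mathcal E:u,w\in T'\cup\mathcal V\}\cup\{u_1w,u_2w:vw\in\mathcal E\}$. A function $f':[k]\to T'\cup\mathcal V$ is compatible with $\pi$ if $f'(a)\in\{u_1,u_2\}$ when $f(a)=v$ and $f'(a)=f(a)$ otherwise. For $\pi_0=(T,D)$, a set $D'\subseteq T'$ is compatible with $\pi_0$ if $D\setminus\{v\}=D'\setminus\{u_1,u_2\}$, $|D'|\le k$, and $v\in D$ iff $u_1\in D'$ or $u_2\in D'$; a set $\{(T_1,D_1),\ldots,(T_m,D_m)\}$ of basic $(i-1)$-profiles is a $D'$-decomposition of $\pi_0$ if the $T_j$ are pairwise disjoint, $T'=\bigcup_jT_j$, $D'=\bigcup_jD_j$, $D'$ is compatible with $\pi_0$, and no red edge of $G_{i-1}$ joins $x\in T_j$ to $y\in D_\ell$ with $j\ne\ell$. For $f'$ compatible with $\pi$, a set $\{\pi_j=(T_j,D_j,\mathcal V_j,\mathcal E_j,f_j,H):j\in[m]\}$ of virtual $(i-1)$-profiles is an $f'$-decomposition of $\pi$ if, with $D'=\mathrm{range}(f')\cap T'$, $\{(T_j,D_j)\}$ is a $D'$-decomposition of $\pi_0$ and for each $j$: $\mathcal V_j=\mathcal V\cup\{h_a:f'(a)\in D'\setminus D_j\}$; $f_j(a)=f'(a)$ if $f'(a)\in D_j\cup\mathcal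 V$ and $f_j(a)=h_a$ if $f'(a)\in D'\setminus D_j$; and $\mathcal E_j$ is the union of $\{uw\in\mathcal E':u,w\in\mathcal V\cup T_j\}$, $\{uh_a:u\in\mathcal V\cup T_j, f'(a)=w\in D'\setminus D_j, uw\in\mathcal E'\cup B(G_{i-1})\}$, and $\{h_ah_b\in E(H):f'(a),f'(b)\in D'\setminus D_j\}$. The operation $\oplus$: for virtual $i$-profiles $\pi_1=(T_1,D_1,\mathcal V_1,\mathcal E_1,f_1,H)$, $\pi_2=(T_2,D_2,\mathcal V_2,\mathcal E_2,f_2,H)$ and solutions $\mathbf s^1,\mathbf s^2$ of them, $\mathbf s^1\oplus\mathbf s^2=(s_1,\ldots,s_k)$ with $s_a=s^1_a$ if $f_1(a)\in D_1$ and $s_a=s^2_a$ otherwise. $\bigoplus_{j\in[m]}\mathbf s^j$ is defined right-nested: $\mathbf s^1$ if $m=1$, and $\mathbf s^1\oplus\bigoplus_{j\in[2,m]}\mathbf s^j$ otherwise. -}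

module Defs where

open import Data.Nat using (ℕ; zero; suc; _+_; _*_; _∸_; _≤_; _≡ᵇ_)
open import Data.Bool using (Bool; true; false; _∧_; _∨_; not; if_then_else_)
open import Data.Fin using (Fin)
import Data.Fin as Fin
open import Data.List using (List; []; _∷_; _++_; length; filterᵇ; allFin; map; take; concatMap)
open import Data.Bool.ListAction using (any)
open import Data.Nat.ListAction using (sum)
open import Data.List.Relation.Unary.Unique.Propositional using (Unique)
open import Data.Maybe using (Maybe; just; nothing)
open import Data.Product using (Σ; ∃; _×_; _,_)
open import Data.Sum using (_⊎_; inj₁; inj₂)
open import Data.Empty using (⊥)
open import Relation.Binary.PropositionalEquality using (_≡_; _≢_)
open import Function.Bundles using (_⇔_)

-- Basic conventions
-- Vertices of G and of all trigraphs G_i are natural numbers (identifiers).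
-- "New objects" (virtual vertices, vertices of H) are also natural numbers,
-- but they live on the right of a sum type, so they are automatically
-- disjoint from all (trigraph) vertices.

Node : Set
Node = ℕ ⊎ ℕ

_∈ᵇ_ : ℕ → List ℕ → Bool
x ∈ᵇ xs = any (λ y → x ≡ᵇ y) xs

eqN : Node → Node → Bool
eqN (inj₁ x) (inj₁ y) = x ≡ᵇ y
eqN (inj₂ x) (inj₂ y) = x ≡ᵇ y
eqN (inj₁ _) (inj₂ _) = false
eqN (inj₂ _) (inj₁ _) = false

inTV : List ℕ → List ℕ → Node → Bool
inTV T 𝒱 (inj₁ x) = x ∈ᵇ T
inTV T 𝒱 (inj₂ o) = o ∈ᵇ 𝒱

record Graph : Set where
  field
    V     : List ℕ
    E     : ℕ → ℕ → Bool
    uniq  : Unique V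
    sym   : ∀ x y → E x y ≡ E y x
    irr   : ∀ x → E x x ≡ false

record Trigraph : Set where
  field
    V     : List ℕ
    black : ℕ → ℕ → Bool
    red   : ℕ → ℕ → Bool

toTrigraph : Graph → Trigraph
toTrigraph G = record
  { V = Graph.V G
  ; black = λ x y → (x ∈ᵇ Graph.V G) ∧ (y ∈ᵇ Graph.V G) ∧ Graph.E G x y
  ; red = λ _ _ → false
  }

contract : Trigraph → ℕ → ℕ → ℕ → Trigraph
contract Tg u v w = record { V = V' ; black = black' ; red = red' }
  where
  open Trigraph Tg
  V' : List ℕ
  V' = w ∷ filterᵇ (λ x → not ((x ≡ᵇ u) ∨ (x ≡ᵇ v))) V
  adj : ℕ → ℕ → Bool
  adj a b = black a b ∨ red a b
  bw : ℕ → Bool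
  bw z = black u z ∧ black v z
  rw : ℕ → Bool
  rw z = red u z ∨ red v z ∨ (black u z ∧ not (adj v z)) ∨ (black v z ∧ not (adj u z))
  black' : ℕ → ℕ → Bool
  black' x y = (x ∈ᵇ V') ∧ (y ∈ᵇ V') ∧ not (x ≡ᵇ y) ∧
    (if x ≡ᵇ w then bw y else (if y ≡ᵇ w then bw x else black x y))
  red' : ℕ → ℕ → Bool
  red' x y = (x ∈ᵇ V') ∧ (y ∈ᵇ V') ∧ not (x ≡ᵇ y) ∧
    (if x ≡ᵇ w then rw y else (if y ≡ᵇ w then rw x else red x y))

Step : Set
Step = ℕ × ℕ × ℕ

applySteps : Trigraph → List Step → Trigraph
applySteps Tg [] = Tg
applySteps Tg ((u , v , w) ∷ ss) = applySteps (contract Tg u v w) ss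

ValidStep : Trigraph → Step → Set
ValidStep Tg (u , v , w) =
  u ≢ v × (u ∈ᵇ Trigraph.V Tg) ≡ true × (v ∈ᵇ Trigraph.V Tg) ≡ true
    × (w ∈ᵇ Trigraph.V Tg) ≡ false

ValidSeq : Trigraph → List Step → Set
ValidSeq Tg [] = length (Trigraph.V Tg) ≡ 1
ValidSeq Tg ((u , v , w) ∷ ss) = ValidStep Tg (u , v , w) × ValidSeq (contract Tg u v w) ss

-- A contraction sequence (G = G_1, ..., G_n), given by its n-1 contractions
record ContrSeq (G : Graph) : Set where
  field
    steps : List Step
    valid : ValidSeq (toTrigraph G) steps

lenSeq : {G : Graph} → ContrSeq G → ℕ
lenSeq S = suc (length (ContrSeq.steps S))

-- G_i  (1-based: G_1 = G)
Gat : {G : Graph} → ContrSeq G → ℕ → Trigraph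
Gat {G} S i = applySteps (toTrigraph G) (take (i ∸ 1) (ContrSeq.steps S))

bagAfter : (ℕ → List ℕ) → List Step → ℕ → List ℕ
bagAfter b [] = b
bagAfter b ((u , v , w) ∷ ss) =
  bagAfter (λ x → if x ≡ᵇ w then b u ++ b v else b x) ss

βat : {G : Graph} → ContrSeq G → ℕ → ℕ → List ℕ
βat S i = bagAfter (λ x → x ∷ []) (take (i ∸ 1) (ContrSeq.steps S))

βset : {G : Graph} → ContrSeq G → ℕ → List ℕ → List ℕ
βset S i X = concatMap (βat S i) X

nth : {A : Set} → List A → ℕ → Maybe A
nth [] _ = nothing
nth (x ∷ xs) zero = just x
nth (x ∷ xs) (suc j) = nth xs j

-- the contraction producing G_i from G_{i-1} (i ≥ 2): (u1 , u2 , v)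
stepAt : {G : Graph} → ContrSeq G → ℕ → Maybe Step
stepAt S i = nth (ContrSeq.steps S) (i ∸ 2)

redDeg : Trigraph → ℕ → ℕ
redDeg Tg x = length (filterᵇ (λ y → Trigraph.red Tg x y) (Trigraph.V Tg))

HasWidth : {G : Graph} → ContrSeq G → ℕ → Set
HasWidth S d =
  (∀ i → 1 ≤ i → i ≤ lenSeq S → ∀ x → (x ∈ᵇ Trigraph.V (Gat S i)) ≡ true →
     redDeg (Gat S i) x ≤ d)
  × Σ ℕ (λ i → Σ ℕ (λ x → 1 ≤ i × i ≤ lenSeq S × (x ∈ᵇ Trigraph.V (Gat S i)) ≡ true
        × redDeg (Gat S i) x ≡ d))

data Var (k : ℕ) : Set where
  x : Fin k → Var k
  y : Var k

data QF (k : ℕ) : Set where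
  tt ff : QF k
  eq  : Var k → Var k → QF k
  edge : Var k → Var k → QF k
  neg : QF k → QF k
  and or : QF k → QF k → QF k

evalQF : {k : ℕ} → (Node → Node → Bool) → (Var k → Node) → QF k → Bool
evalQF adj ρ tt = true
evalQF adj ρ ff = false
evalQF adj ρ (eq a b) = eqN (ρ a) (ρ b)
evalQF adj ρ (edge a b) = adj (ρ a) (ρ b)
evalQF adj ρ (neg φ) = not (evalQF adj ρ φ)
evalQF adj ρ (and φ χ) = evalQF adj ρ φ ∧ evalQF adj ρ χ
evalQF adj ρ (or φ χ) = evalQF adj ρ φ ∨ evalQF adj ρ χ

env : {k : ℕ} → (Fin k → Node) → Node → Var k → Node
env s u (x a) = s a
env s u y = u

data RedReach (Tg : Trigraph) (T : List ℕ) : ℕ → ℕ → Set where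
  here : ∀ {a} → RedReach Tg T a a
  step : ∀ {a b c} → Trigraph.red Tg a b ≡ true → (b ∈ᵇ T) ≡ true →
         RedReach Tg T b c → RedReach Tg T a c

RedConnected : Trigraph → List ℕ → Set
RedConnected Tg T = ∀ a b → (a ∈ᵇ T) ≡ true → (b ∈ᵇ T) ≡ true → RedReach Tg T a b

BasicProfile : {G : Graph} → ContrSeq G → (k d i : ℕ) → List ℕ → List ℕ → Set
BasicProfile S k d i T D =
  Unique T × (∀ a → (a ∈ᵇ T) ≡ true → (a ∈ᵇ Trigraph.V (Gat S i)) ≡ true)
  × length T ≤ k * (d + 1) × RedConnected (Gat S i) T
  × Unique D × (∀ a → (a ∈ᵇ D) ≡ true → (a ∈ᵇ T) ≡ true) × length D ≤ k

-- a graph H with vertices labelled h_1..h_k (vertices are new objects)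
record LGraph (k : ℕ) : Set where
  field
    V : List ℕ
    E : ℕ → ℕ → Bool
    h : Fin k → ℕ

IsLGraph : (k : ℕ) → LGraph k → Set
IsLGraph k H =
  Unique V × length V ≤ k × (∀ a b → E a b ≡ E b a) × (∀ a → E a a ≡ false)
  × (∀ a → (h a ∈ᵇ V) ≡ true) × (∀ z → (z ∈ᵇ V) ≡ true → Σ (Fin k) (λ a → h a ≡ z))
  where open LGraph H

-- the data (T, D, 𝒱, 𝓔, f) of a virtual profile; H is kept as a separate
-- parameter (all profiles in a decomposition share the same H).
-- 𝓔 is a symmetric relation on nodes (a set of unordered pairs).
record VData (k : ℕ) : Set where
  field
    T D 𝒱 : List ℕ
    𝓔 : Node → Node → Bool
    f : Fin k → Node

count : {k : ℕ} → (Fin k → Bool) → ℕ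
count {k} P = length (filterᵇ P (allFin k))

isVirt : List ℕ → Node → Bool
isVirt 𝒱 = inTV [] 𝒱

IsVirtualProfile : {G : Graph} → ContrSeq G → (k d i : ℕ) → LGraph k → VData k → Set
IsVirtualProfile S k d i H π =
  BasicProfile S k d i T D
  × Unique 𝒱 × length 𝒱 ≤ k
  × (∀ p q → 𝓔 p q ≡ 𝓔 q p)
  × (∀ p q → 𝓔 p q ≡ true →
       p ≢ q × ((inTV T 𝒱 p ≡ true × isVirt 𝒱 q ≡ true)
                ⊎ (isVirt 𝒱 p ≡ true × inTV T 𝒱 q ≡ true)))
  × (∀ a → inTV D 𝒱 (f a) ≡ true)
  × (∀ z → inTV D 𝒱 z ≡ true → Σ (Fin k) (λ a → f a ≡ z))
  × (∀ u → (u ∈ᵇ D) ≡ true → count (λ a → eqN (f a) (inj₁ u)) ≤ length (βat S i u))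
  × IsLGraph k H
  where open VData π

-- the expanded graph G_π : vertex set and adjacency on Node
-- (inj₁ x = vertex x of G, inj₂ o = virtual vertex o)
inGπ : {G : Graph} → ContrSeq G → ℕ → {k : ℕ} → VData k → Node → Bool
inGπ S i π (inj₁ a) = a ∈ᵇ βset S i (VData.T π)
inGπ S i π (inj₂ o) = o ∈ᵇ VData.𝒱 π

adjGπ : {G : Graph} → ContrSeq G → ℕ → {k : ℕ} → VData k → Node → Node → Bool
adjGπ {G} S i π (inj₁ a) (inj₁ b) =
  (a ∈ᵇ βset S i (VData.T π)) ∧ (b ∈ᵇ βset S i (VData.T π)) ∧ Graph.E G a b
adjGπ S i π (inj₂ o) (inj₂ o') = VData.𝓔 π (inj₂ o) (inj₂ o')
adjGπ S i π (inj₁ a) (inj₂ o) =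
  any (λ u → (a ∈ᵇ βat S i u) ∧ VData.𝓔 π (inj₁ u) (inj₂ o)) (VData.T π)
adjGπ S i π (inj₂ o) (inj₁ a) =
  any (λ u → (a ∈ᵇ βat S i u) ∧ VData.𝓔 π (inj₁ u) (inj₂ o)) (VData.T π)

Solution : {G : Graph} → ContrSeq G → (i : ℕ) → {k : ℕ} → LGraph k → VData k →
           (Fin k → Node) → Set
Solution S i {k} H π s =
  (∀ a → inGπ S i π (s a) ≡ true)
  × (∀ a o → VData.f π a ≡ inj₂ o → s a ≡ inj₂ o)
  × (∀ a u → VData.f π a ≡ inj₁ u → Σ ℕ (λ z → s a ≡ inj₁ z × (z ∈ᵇ βat S i u) ≡ true))
  -- s_a ↦ h_a is a well-defined isomorphism G_π[{s_1..s_k}] → H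
  × (∀ a b → s a ≡ s b → LGraph.h H a ≡ LGraph.h H b)
  × (∀ a b → LGraph.h H a ≡ LGraph.h H b → s a ≡ s b)
  × (∀ a b → adjGπ S i π (s a) (s b) ≡ LGraph.E H (LGraph.h H a) (LGraph.h H b))

value : {G : Graph} → ContrSeq G → (i : ℕ) → {k p : ℕ} → (Fin p → QF k) →
        VData k → (Fin k → Node) → ℕ
value S i {k} {p} ψ π s =
  sum (map (λ α → length (filterᵇ (λ u → evalQF (adjGπ S i π) (env s (inj₁ u)) (ψ α))
                                  (βset S i (VData.T π))))
           (allFin p))

T' : List ℕ → ℕ → ℕ → ℕ → List ℕ
T' T u1 u2 v = u1 ∷ u2 ∷ filterᵇ (λ a → not (a ≡ᵇ v)) T

D' : {k : ℕ} → List ℕ → ℕ → ℕ → ℕ → (Fin k → Node) → List ℕ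
D' {k} T u1 u2 v f' =
  filterᵇ (λ a → any (λ b → eqN (f' b) (inj₁ a)) (allFin k)) (T' T u1 u2 v)

𝓔' : {k : ℕ} → VData k → ℕ → ℕ → ℕ → Node → Node → Bool
𝓔' π u1 u2 v p q =
  (𝓔 p q ∧ inTV (T' T u1 u2 v) 𝒱 p ∧ inTV (T' T u1 u2 v) 𝒱 q)
  ∨ (isU p ∧ 𝓔 (inj₁ v) q) ∨ (isU q ∧ 𝓔 p (inj₁ v))
  where
  open VData π
  isU : Node → Bool
  isU z = eqN z (inj₁ u1) ∨ eqN z (inj₁ u2)

Compatible : {k : ℕ} → VData k → ℕ → ℕ → ℕ → (Fin k → Node) → Set
Compatible π u1 u2 v f' =
  ∀ a → (VData.f π a ≡ inj₁ v → f' a ≡ inj₁ u1 ⊎ f' a ≡ inj₁ u2)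
      × (VData.f π a ≢ inj₁ v → f' a ≡ VData.f π a)

DCompatible : (k : ℕ) → List ℕ → ℕ → ℕ → ℕ → List ℕ → Set
DCompatible k D u1 u2 v Dp =
  (∀ a → (((a ∈ᵇ D) ≡ true × a ≢ v) ⇔ ((a ∈ᵇ Dp) ≡ true × a ≢ u1 × a ≢ u2)))
  × length Dp ≤ k
  × ((v ∈ᵇ D) ≡ true ⇔ ((u1 ∈ᵇ Dp) ≡ true ⊎ (u2 ∈ᵇ Dp) ≡ true))

-- {(T_j , D_j) : j} is a Dp-decomposition of π₀ = (T , D); the members being
-- basic (i-1)-profiles is required separately (IsVirtualProfile at i-1).
DDecomp : {G : Graph} → ContrSeq G → (k i : ℕ) → List ℕ → List ℕ → ℕ → ℕ → ℕ →
          List ℕ → (m : ℕ) → (Fin m → List ℕ) → (Fin m → List ℕ) → Set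
DDecomp S k i T D u1 u2 v Dp m Ts Ds =
  (∀ j l → j ≢ l → ∀ a → (a ∈ᵇ Ts j) ≡ true → (a ∈ᵇ Ts l) ≡ true → ⊥)
  × (∀ a → (a ∈ᵇ T' T u1 u2 v) ≡ true ⇔ Σ (Fin m) (λ j → (a ∈ᵇ Ts j) ≡ true))
  × (∀ a → (a ∈ᵇ Dp) ≡ true ⇔ Σ (Fin m) (λ j → (a ∈ᵇ Ds j) ≡ true))
  × DCompatible k D u1 u2 v Dp
  × (∀ j l → j ≢ l → ∀ a b → (a ∈ᵇ Ts j) ≡ true → (b ∈ᵇ Ds l) ≡ true →
       Trigraph.red (Gat S (i ∸ 1)) a b ≡ false)

-- the ordered-pair generators of 𝓔_j (𝓔_j is their symmetric closure)
EjGen : {G : Graph} → ContrSeq G → (i : ℕ) → {k : ℕ} → LGraph k → VData k →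
        ℕ → ℕ → ℕ → (Fin k → Node) → (Tj Dj : List ℕ) → Node → Node → Set
EjGen S i {k} H π u1 u2 v f' Tj Dj p q =
  (𝓔' π u1 u2 v p q ≡ true × inTV Tj 𝒱 p ≡ true × inTV Tj 𝒱 q ≡ true)
  ⊎ Σ (Fin k) (λ a → Σ ℕ (λ w →
       q ≡ inj₂ (LGraph.h H a) × inTV Tj 𝒱 p ≡ true × f' a ≡ inj₁ w × inDD w
       × (𝓔' π u1 u2 v p (inj₁ w) ≡ true
          ⊎ Σ ℕ (λ u → p ≡ inj₁ u × Trigraph.black (Gat S (i ∸ 1)) u w ≡ true))))
  ⊎ Σ (Fin k) (λ a → Σ (Fin k) (λ b →
       p ≡ inj₂ (LGraph.h H a) × q ≡ inj₂ (LGraph.h H b)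
       × LGraph.E H (LGraph.h H a) (LGraph.h H b) ≡ true
       × Σ ℕ (λ w → f' a ≡ inj₁ w × inDD w) × Σ ℕ (λ w → f' b ≡ inj₁ w × inDD w)))
  where
  open VData π
  inDD : ℕ → Set
  inDD w = (w ∈ᵇ D' T u1 u2 v f') ≡ true × (w ∈ᵇ Dj) ≡ false

FDecomp : {G : Graph} → ContrSeq G → (k d i : ℕ) → LGraph k → VData k →
          ℕ → ℕ → ℕ → (Fin k → Node) → (m : ℕ) → (Fin m → VData k) → Set
FDecomp S k d i H π u1 u2 v f' m πs =
  (v ∈ᵇ VData.T π) ≡ true
  × (∀ j → IsVirtualProfile S k d (i ∸ 1) H (πs j))
  × DDecomp S k i (VData.T π) (VData.D π) u1 u2 v Dp m (λ j → VData.T (πs j)) (λ j → VData.D (πs j))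
  × (∀ j → let Tj = VData.T (πs j) ; Dj = VData.D (πs j) in
       (∀ o → (o ∈ᵇ VData.𝒱 (πs j)) ≡ true ⇔
              ((o ∈ᵇ VData.𝒱 π) ≡ true
               ⊎ Σ (Fin k) (λ a → o ≡ LGraph.h H a
                   × Σ ℕ (λ w → f' a ≡ inj₁ w × (w ∈ᵇ Dp) ≡ true × (w ∈ᵇ Dj) ≡ false))))
       × (∀ a → (inTV Dj (VData.𝒱 π) (f' a) ≡ true → VData.f (πs j) a ≡ f' a)
              × (∀ w → f' a ≡ inj₁ w → (w ∈ᵇ Dp) ≡ true → (w ∈ᵇ Dj) ≡ false →
                   VData.f (πs j) a ≡ inj₂ (LGraph.h H a)))
       × (∀ p q → VData.𝓔 (πs j) p q ≡ true ⇔
              (EjGen S i H π u1 u2 v f' Tj Dj p q ⊎ EjGen S i H π u1 u2 v f' Tj Dj q p)))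
  where
  Dp : List ℕ
  Dp = D' (VData.T π) u1 u2 v f'

inD : {k : ℕ} → VData k → Node → Bool
inD π (inj₁ a) = a ∈ᵇ VData.D π
inD π (inj₂ _) = false

_⊕⟨_⟩_ : {k : ℕ} → (Fin k → Node) → VData k → (Fin k → Node) → (Fin k → Node)
(s1 ⊕⟨ π1 ⟩ s2) a = if inD π1 (VData.f π1 a) then s1 a else s2 a

bigOplus : {k : ℕ} → (m : ℕ) → (Fin (suc m) → VData k) → (Fin (suc m) → Fin k → Node) →
           Fin k → Node
bigOplus zero πs ss = ss Fin.zero
bigOplus (suc m) πs ss =
  ss Fin.zero ⊕⟨ πs Fin.zero ⟩ bigOplus m (λ j → πs (Fin.suc j)) (λ j → ss (Fin.suc j))

-- Each coordinate a of s = ⊕ⱼ sʲ is taken from the unique piece πⱼ whose Dⱼ contains f′(a) (its owner),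
-- while coordinates sent to old virtual vertices agree in all pieces. Every atomic fact about s in G_π can
-- then be read off one piece: facts inside a piece are literally the same, and an adjacency between a
-- vertex u of piece j and a coordinate a owned by another piece J appears in πⱼ as an edge to the new
-- virtual vertex h_a. Because no red edge of G_{i-1} joins Tⱼ to D_J, the bags of G_{i-1} are homogeneous
-- between them, so that virtual edge reproduces the edge of G exactly. Hence s is a solution of π, each
-- ψ_α holds at u for s iff it holds for sʲ where u lies in β(Tⱼ), and the value splits since β(T) in G_i
-- is the disjoint union of the β(Tⱼ) in G_{i-1}.

module Submission where

open import Defs
import Algebra.Properties.CommutativeSemigroup as CommutativeSemigroup
open import Data.Bool using (Bool; true; false; _∧_; _∨_; not; if_then_else_)
open import Data.Bool.ListAction using (any)
open import Data.Bool.Properties using (T-≡; ¬-not; ∨-identityʳ; ∧-identityʳ; ∧-zeroʳ; ∨-idem)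
open import Data.Empty using (⊥; ⊥-elim)
open import Data.Fin using (Fin)
import Data.Fin as Fin
open import Data.List using (List; []; _∷_; _++_; length; filterᵇ; allFin; map; take; concatMap)
open import Data.List.Membership.Propositional using (_∈_; find; lose)
open import Data.List.Membership.Propositional.Properties
  using (∈-allFin; ∈-++⁻; ∈-++⁺ˡ; ∈-++⁺ʳ; ∈-concatMap⁺; ∈-concatMap⁻; ∈-filter⁺; ∈-filter⁻)
open import Data.List.Membership.Propositional.Properties.WithK using (unique∧set⇒bag)
open import Data.List.Properties using (length-++; map-++; filter-++; map-cong-local)
open import Data.List.Relation.Binary.BagAndSetEquality using (∼bag⇒↭)
import Data.List.Relation.Binary.Permutation.Propositional.Properties as Perm
open import Data.List.Relation.Binary.Disjoint.Propositional using (Disjoint)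
open import Data.List.Relation.Unary.All as All using (_∷_)
import Data.List.Relation.Unary.All.Properties as All
open import Data.List.Relation.Unary.AllPairs as AllPairs using (_∷_)
import Data.List.Relation.Unary.AllPairs.Properties as AllPairs
open import Data.List.Relation.Unary.Any using (here; there)
import Data.List.Relation.Unary.Any.Properties as Any
open import Data.List.Relation.Unary.Unique.Propositional using (Unique)
import Data.List.Relation.Unary.Unique.Propositional.Properties as Unique
open import Data.Maybe using (just)
open import Data.Nat using (ℕ; zero; suc; _+_; _∸_; _≤_; _≡ᵇ_; s≤s)
open import Data.Nat.ListAction using (sum)
open import Data.Nat.ListAction.Properties using (sum-++; sum-↭)
open import Data.Nat.Properties using (_≟_; ≡ᵇ⇒≡; ≡⇒≡ᵇ; +-assoc; +-commutativeSemigroup)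
open import Data.Product using (Σ; ∃; _×_; _,_; proj₁; proj₂)
open import Data.Sum using (_⊎_; inj₁; inj₂)
open import Function using (_∘_)
open import Function.Bundles using (_⇔_; mk⇔; Equivalence)
open import Relation.Binary.PropositionalEquality
  using (_≡_; _≢_; refl; sym; trans; cong; cong₂; subst; module ≡-Reasoning)
open import Relation.Nullary using (yes; no)
open import Relation.Nullary.Decidable using (T?)

open Equivalence using (to; from)

bool-ext : ∀ {b c : Bool} → (b ≡ true → c ≡ true) → (c ≡ true → b ≡ true) → b ≡ c
bool-ext {false} {false} _ _ = refl
bool-ext {false} {true}  _ g = g refl
bool-ext {true}  {false} f _ = sym (f refl)
bool-ext {true}  {true}  _ _ = refl

≡true⇒≢false : ∀ {b} → b ≡ true → b ≢ false
≡true⇒≢false refl ()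

∨-true⁻ : ∀ {a b} → a ∨ b ≡ true → a ≡ true ⊎ b ≡ true
∨-true⁻ {true}  _ = inj₁ refl
∨-true⁻ {false} e = inj₂ e

∨-trueˡ : ∀ {a} b → a ≡ true → a ∨ b ≡ true
∨-trueˡ b refl = refl

∨-trueʳ : ∀ a {b} → b ≡ true → a ∨ b ≡ true
∨-trueʳ true  _ = refl
∨-trueʳ false e = e

∧-true⁻ˡ : ∀ {a b} → a ∧ b ≡ true → a ≡ true
∧-true⁻ˡ {true} _ = refl

∧-true⁻ʳ : ∀ {a b} → a ∧ b ≡ true → b ≡ true
∧-true⁻ʳ {true} e = e

∧-true⁺ : ∀ {a b} → a ≡ true → b ≡ true → a ∧ b ≡ true
∧-true⁺ refl refl = refl

not-true⇒false : ∀ {a} → not a ≡ true → a ≡ false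
not-true⇒false {false} _ = refl

not-∨-true⁻ : ∀ a b → not (a ∨ b) ≡ true → a ≡ false × b ≡ false
not-∨-true⁻ false false _ = refl , refl

≡ᵇ-true⇒≡ : ∀ {m n} → (m ≡ᵇ n) ≡ true → m ≡ n
≡ᵇ-true⇒≡ {m} {n} e = ≡ᵇ⇒≡ m n (from T-≡ e)

≡ᵇ-refl : ∀ n → (n ≡ᵇ n) ≡ true
≡ᵇ-refl n = to T-≡ (≡⇒≡ᵇ n n refl)

≢⇒≡ᵇ-false : ∀ {m n} → m ≢ n → (m ≡ᵇ n) ≡ false
≢⇒≡ᵇ-false m≢n = ¬-not (m≢n ∘ ≡ᵇ-true⇒≡)

≡ᵇ-false⇒≢ : ∀ {m n} → (m ≡ᵇ n) ≡ false → m ≢ n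
≡ᵇ-false⇒≢ {m} e refl = ≡true⇒≢false (≡ᵇ-refl m) e

eqN⇒≡ : ∀ {p q} → eqN p q ≡ true → p ≡ q
eqN⇒≡ {inj₁ _} {inj₁ _} e = cong inj₁ (≡ᵇ-true⇒≡ e)
eqN⇒≡ {inj₂ _} {inj₂ _} e = cong inj₂ (≡ᵇ-true⇒≡ e)

eqN-refl : ∀ p → eqN p p ≡ true
eqN-refl (inj₁ n) = ≡ᵇ-refl n
eqN-refl (inj₂ n) = ≡ᵇ-refl n

eqN-cong : ∀ {p q p′ q′} → (p ≡ q → p′ ≡ q′) → (p′ ≡ q′ → p ≡ q) → eqN p q ≡ eqN p′ q′
eqN-cong {p} {q} {p′} f g =
  bool-ext (λ e → subst (λ r → eqN p′ r ≡ true) (f (eqN⇒≡ e)) (eqN-refl p′))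
           (λ e → subst (λ r → eqN p r ≡ true) (g (eqN⇒≡ e)) (eqN-refl p))

inj₁≢inj₂ : ∀ {a b : ℕ} → _≢_ {A = Node} (inj₁ a) (inj₂ b)
inj₁≢inj₂ ()

inj₁-injective : ∀ {a b : ℕ} → _≡_ {A = Node} (inj₁ a) (inj₁ b) → a ≡ b
inj₁-injective refl = refl

inj₂-injective : ∀ {a b : ℕ} → _≡_ {A = Node} (inj₂ a) (inj₂ b) → a ≡ b
inj₂-injective refl = refl

module _ {A : Set} {P : A → Bool} where

  any-true⁻ : ∀ {xs} → any P xs ≡ true → ∃ λ a → a ∈ xs × P a ≡ true
  any-true⁻ {xs} e with find (Any.any⁻ P xs (from T-≡ e))
  ... | a , a∈xs , Pa = a , a∈xs , to T-≡ Pa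

  any-true⁺ : ∀ {xs a} → a ∈ xs → P a ≡ true → any P xs ≡ true
  any-true⁺ a∈xs Pa = to T-≡ (Any.any⁺ P (lose a∈xs (from T-≡ Pa)))

∈-filterᵇ⁺ : {A : Set} (P : A → Bool) {xs : List A} {a : A} → a ∈ xs → P a ≡ true → a ∈ filterᵇ P xs
∈-filterᵇ⁺ P a∈xs Pa = ∈-filter⁺ (T? ∘ P) a∈xs (from T-≡ Pa)

∈-filterᵇ⁻ : {A : Set} (P : A → Bool) (xs : List A) {a : A} → a ∈ filterᵇ P xs → a ∈ xs × P a ≡ true
∈-filterᵇ⁻ P xs a∈ with ∈-filter⁻ (T? ∘ P) {xs = xs} a∈
... | a∈xs , Pa = a∈xs , to T-≡ Pa

any-guarded : {P : ℕ → Bool} (g : ℕ → Bool) {t₀ : ℕ} (L : List ℕ) → t₀ ∈ L → P t₀ ≡ true →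
  (∀ t → t ∈ L → t ≢ t₀ → P t ≡ false) → any (λ t → P t ∧ g t) L ≡ g t₀
any-guarded {P} g {t₀} L t₀∈L Pt₀ others = bool-ext to′ (λ e → any-true⁺ t₀∈L (∧-true⁺ Pt₀ e))
  where
  to′ : any (λ t → P t ∧ g t) L ≡ true → g t₀ ≡ true
  to′ e with any-true⁻ e
  ... | t , t∈L , Pg with t ≟ t₀
  ... | yes refl = ∧-true⁻ʳ {P t} Pg
  ... | no t≢t₀ = ⊥-elim (≡true⇒≢false (∧-true⁻ˡ Pg) (others t t∈L t≢t₀))

_∈ᵗ_ : ℕ → List ℕ → Set
a ∈ᵗ xs = (a ∈ᵇ xs) ≡ true

∈ᵗ⇒∈ : ∀ a xs → a ∈ᵗ xs → a ∈ xs
∈ᵗ⇒∈ a xs e with any-true⁻ e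
... | b , b∈xs , a≡b = subst (_∈ xs) (sym (≡ᵇ-true⇒≡ a≡b)) b∈xs

∈⇒∈ᵗ : ∀ {a xs} → a ∈ xs → a ∈ᵗ xs
∈⇒∈ᵗ {a} a∈xs = any-true⁺ a∈xs (≡ᵇ-refl a)

∈ᵗ-++⁻ : ∀ z xs ys → z ∈ᵗ (xs ++ ys) → z ∈ᵗ xs ⊎ z ∈ᵗ ys
∈ᵗ-++⁻ z xs ys e with ∈-++⁻ xs (∈ᵗ⇒∈ z (xs ++ ys) e)
... | inj₁ z∈xs = inj₁ (∈⇒∈ᵗ z∈xs)
... | inj₂ z∈ys = inj₂ (∈⇒∈ᵗ z∈ys)

countᵇ : {A : Set} → (A → Bool) → List A → ℕ
countᵇ P L = length (filterᵇ P L)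

module _ {A : Set} where

  countᵇ-++ : (P : A → Bool) (xs ys : List A) → countᵇ P (xs ++ ys) ≡ countᵇ P xs + countᵇ P ys
  countᵇ-++ P xs ys = trans (cong length (filter-++ (T? ∘ P) xs ys)) (length-++ (filterᵇ P xs))

  countᵇ-cong-local : (P Q : A → Bool) (L : List A) → (∀ u → u ∈ L → P u ≡ Q u) →
    countᵇ P L ≡ countᵇ Q L
  countᵇ-cong-local P Q [] _ = refl
  countᵇ-cong-local P Q (a ∷ L) P≡Q with P a | Q a | P≡Q a (here refl)
  ... | true  | true  | _ = cong suc (countᵇ-cong-local P Q L (λ u u∈L → P≡Q u (there u∈L)))
  ... | false | false | _ = countᵇ-cong-local P Q L (λ u u∈L → P≡Q u (there u∈L))

  sum-map-cong-local : (g h : A → ℕ) (L : List A) → (∀ t → t ∈ L → g t ≡ h t) →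
    sum (map g L) ≡ sum (map h L)
  sum-map-cong-local g h L g≡h = cong sum (map-cong-local (All.tabulate (g≡h _)))

  sum-map-concatMap : {B : Set} (g : A → ℕ) (β : B → List A) (L : List B) →
    sum (map g (concatMap β L)) ≡ sum (map (λ b → sum (map g (β b))) L)
  sum-map-concatMap g β [] = refl
  sum-map-concatMap g β (b ∷ L) = begin
    sum (map g (β b ++ concatMap β L))                 ≡⟨ cong sum (map-++ g (β b) (concatMap β L)) ⟩
    sum (map g (β b) ++ map g (concatMap β L))         ≡⟨ sum-++ (map g (β b)) _ ⟩
    sum (map g (β b)) + sum (map g (concatMap β L))    ≡⟨ cong (sum (map g (β b)) +_) (sum-map-concatMap g β L) ⟩
    sum (map g (β b)) + sum (map (λ b → sum (map g (β b))) L) ∎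
    where open ≡-Reasoning

  countᵇ-concatMap : {B : Set} (P : A → Bool) (β : B → List A) (L : List B) →
    countᵇ P (concatMap β L) ≡ sum (map (λ b → countᵇ P (β b)) L)
  countᵇ-concatMap P β [] = refl
  countᵇ-concatMap P β (b ∷ L) =
    trans (countᵇ-++ P (β b) (concatMap β L)) (cong (countᵇ P (β b) +_) (countᵇ-concatMap P β L))

  sum-map-unique-set : (g : A → ℕ) {L L′ : List A} → Unique L → Unique L′ →
    (∀ {t} → t ∈ L ⇔ t ∈ L′) → sum (map g L) ≡ sum (map g L′)
  sum-map-unique-set g U U′ L≈L′ = sum-↭ (Perm.map⁺ g (∼bag⇒↭ (unique∧set⇒bag U U′ L≈L′)))

  unique-concatMap : {B : Set} (β : B → List A) {L : List B} → Unique L → (∀ b → Unique (β b)) →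
    (∀ {b c} → b ≢ c → Disjoint (β b) (β c)) → Unique (concatMap β L)
  unique-concatMap β UL Uβ disjoint =
    Unique.concat⁺ (All.map⁺ (All.tabulate (λ {b} _ → Uβ b))) (AllPairs.map⁺ (AllPairs.map disjoint UL))

sum-map-+ : {A : Set} (f g : A → ℕ) (L : List A) →
  sum (map (λ a → f a + g a) L) ≡ sum (map f L) + sum (map g L)
sum-map-+ f g [] = refl
sum-map-+ f g (a ∷ L) = trans (cong (f a + g a +_) (sum-map-+ f g L))
  (CommutativeSemigroup.interchange +-commutativeSemigroup (f a) (g a) _ _)

sum-map-swap : {I J : Set} (F : J → I → ℕ) (Is : List I) (Js : List J) →
  sum (map (λ a → sum (map (λ j → F j a) Js)) Is) ≡ sum (map (λ j → sum (map (F j) Is)) Js)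
sum-map-swap F Is [] = sum-map-zero Is
  where
  sum-map-zero : ∀ Is → sum (map (λ _ → 0) Is) ≡ 0
  sum-map-zero [] = refl
  sum-map-zero (_ ∷ Is) = sum-map-zero Is
sum-map-swap F Is (j ∷ Js) =
  trans (sum-map-+ (F j) _ Is) (cong (sum (map (F j) Is) +_) (sum-map-swap F Is Js))

module _ (G : Graph) where
  open Graph G using () renaming (E to GE; sym to GE-sym)

  record HomogeneousBags (Tg : Trigraph) (β : ℕ → List ℕ) : Set where
    open Trigraph Tg
    field
      disjoint : ∀ p q → p ∈ᵗ V → q ∈ᵗ V → p ≢ q → ∀ z → z ∈ᵗ β p → z ∈ᵗ β q → ⊥
      homogeneous : ∀ p q → p ∈ᵗ V → q ∈ᵗ V → p ≢ q → ∀ a c → a ∈ᵗ β p → c ∈ᵗ β q →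
        (black p q ≡ true → GE a c ≡ true) × (black p q ≡ false → red p q ≡ false → GE a c ≡ false)

  ∈ᵗ-singleton⁻ : ∀ {z p} → z ∈ᵗ (p ∷ []) → z ≡ p
  ∈ᵗ-singleton⁻ {z} {p} e with ∈ᵗ⇒∈ z (p ∷ []) e
  ... | here z≡p = z≡p

  homogeneousBags-initial : HomogeneousBags (toTrigraph G) (λ p → p ∷ [])
  homogeneousBags-initial = record
    { disjoint = λ p q _ _ p≢q z z∈p z∈q →
        p≢q (trans (sym (∈ᵗ-singleton⁻ {z} z∈p)) (∈ᵗ-singleton⁻ {z} z∈q))
    ; homogeneous = homogeneous
    }
    where
    homogeneous : ∀ p q → p ∈ᵗ Graph.V G → q ∈ᵗ Graph.V G → p ≢ q → ∀ a c → a ∈ᵗ (p ∷ []) → c ∈ᵗ (q ∷ []) →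
      (Trigraph.black (toTrigraph G) p q ≡ true → GE a c ≡ true)
      × (Trigraph.black (toTrigraph G) p q ≡ false → false ≡ false → GE a c ≡ false)
    homogeneous p q p∈V q∈V _ a c a∈p c∈q
      with ∈ᵗ-singleton⁻ {a} a∈p | ∈ᵗ-singleton⁻ {c} c∈q
    ... | refl | refl rewrite p∈V | q∈V = (λ e → e) , (λ e _ → e)

  merged-nonadjacent⇒parts-nonadjacent : ∀ (bu bv ru rv : Bool) → bu ∧ bv ≡ false →
    (ru ∨ rv ∨ (bu ∧ not (bv ∨ rv)) ∨ (bv ∧ not (bu ∨ ru))) ≡ false →
    (bu ≡ false × ru ≡ false) × (bv ≡ false × rv ≡ false)
  merged-nonadjacent⇒parts-nonadjacent false false false false _ _ = (refl , refl) , (refl , refl)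
  merged-nonadjacent⇒parts-nonadjacent true  true  _     _     () _
  merged-nonadjacent⇒parts-nonadjacent true  false false false _ ()
  merged-nonadjacent⇒parts-nonadjacent false true  false false _ ()
  merged-nonadjacent⇒parts-nonadjacent _     _     true  _     _ ()
  merged-nonadjacent⇒parts-nonadjacent true  false false true  _ ()
  merged-nonadjacent⇒parts-nonadjacent false true  false true  _ ()
  merged-nonadjacent⇒parts-nonadjacent false false false true  _ ()

  module Contraction (Tg : Trigraph) (β : ℕ → List ℕ) (u v w : ℕ) where
    open Trigraph Tg

    Tg′ : Trigraph
    Tg′ = contract Tg u v w

    β′ : ℕ → List ℕ
    β′ p = if p ≡ᵇ w then β u ++ β v else β p

    ∈V-contract⁻ : ∀ p → p ∈ᵗ Trigraph.V Tg′ → p ≡ w ⊎ (p ∈ᵗ V × p ≢ u × p ≢ v)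
    ∈V-contract⁻ p e with ∈ᵗ⇒∈ p (Trigraph.V Tg′) e
    ... | here p≡w = inj₁ p≡w
    ... | there p∈ with ∈-filterᵇ⁻ (λ z → not ((z ≡ᵇ u) ∨ (z ≡ᵇ v))) V p∈
    ... | p∈V , kept with not-∨-true⁻ (p ≡ᵇ u) (p ≡ᵇ v) kept
    ... | p≢ᵇu , p≢ᵇv = inj₂ (∈⇒∈ᵗ p∈V , ≡ᵇ-false⇒≢ p≢ᵇu , ≡ᵇ-false⇒≢ p≢ᵇv)

    β′-w : β′ w ≡ β u ++ β v
    β′-w rewrite ≡ᵇ-refl w = refl

    β′-other : ∀ {p} → p ≢ w → β′ p ≡ β p
    β′-other p≢w rewrite ≢⇒≡ᵇ-false p≢w = refl

    w∈V-contract : w ∈ᵗ Trigraph.V Tg′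
    w∈V-contract rewrite ≡ᵇ-refl w = refl

    edges-from-w : ∀ q → q ∈ᵗ Trigraph.V Tg′ → w ≢ q →
      (Trigraph.black Tg′ w q ≡ (black u q ∧ black v q))
      × (Trigraph.red Tg′ w q ≡ (red u q ∨ red v q ∨ (black u q ∧ not (black v q ∨ red v q))
                                   ∨ (black v q ∧ not (black u q ∨ red u q))))
    edges-from-w q q∈ w≢q rewrite w∈V-contract | q∈ | ≢⇒≡ᵇ-false w≢q | ≡ᵇ-refl w = refl , refl

    edges-to-w : ∀ p → p ∈ᵗ Trigraph.V Tg′ → p ≢ w →
      (Trigraph.black Tg′ p w ≡ (black u p ∧ black v p))
      × (Trigraph.red Tg′ p w ≡ (red u p ∨ red v p ∨ (black u p ∧ not (black v p ∨ red v p))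
                                   ∨ (black v p ∧ not (black u p ∨ red u p))))
    edges-to-w p p∈ p≢w rewrite w∈V-contract | p∈ | ≢⇒≡ᵇ-false p≢w | ≡ᵇ-refl w = refl , refl

    edges-away-from-w : ∀ p q → p ∈ᵗ Trigraph.V Tg′ → q ∈ᵗ Trigraph.V Tg′ → p ≢ q → p ≢ w → q ≢ w →
      (Trigraph.black Tg′ p q ≡ black p q) × (Trigraph.red Tg′ p q ≡ red p q)
    edges-away-from-w p q p∈ q∈ p≢q p≢w q≢w
      rewrite p∈ | q∈ | ≢⇒≡ᵇ-false p≢q | ≢⇒≡ᵇ-false p≢w | ≢⇒≡ᵇ-false q≢w = refl , refl

    module Preserved (hb : HomogeneousBags Tg β) (valid : ValidStep Tg (u , v , w)) where
      open HomogeneousBags hb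

      u∈V : u ∈ᵗ V
      u∈V = let (_ , u∈ , _) = valid in u∈

      v∈V : v ∈ᵗ V
      v∈V = let (_ , _ , v∈ , _) = valid in v∈

      V⇒≢w : ∀ {p} → p ∈ᵗ V → p ≢ w
      V⇒≢w p∈V refl = let (_ , _ , _ , w∉V) = valid in ≡true⇒≢false p∈V w∉V

      β′-w⁻ : ∀ z → z ∈ᵗ β′ w → z ∈ᵗ β u ⊎ z ∈ᵗ β v
      β′-w⁻ z e = ∈ᵗ-++⁻ z (β u) (β v) (subst (z ∈ᵗ_) β′-w e)

      β′-other⁻ : ∀ z p → p ∈ᵗ V → z ∈ᵗ β′ p → z ∈ᵗ β p
      β′-other⁻ z p p∈V e = subst (z ∈ᵗ_) (β′-other (V⇒≢w p∈V)) e

      disjoint-w : ∀ q → q ∈ᵗ V → q ≢ u → q ≢ v → ∀ z → z ∈ᵗ β′ w → z ∈ᵗ β′ q → ⊥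
      disjoint-w q q∈V q≢u q≢v z z∈w z∈q with β′-w⁻ z z∈w
      ... | inj₁ z∈u = disjoint u q u∈V q∈V (q≢u ∘ sym) z z∈u (β′-other⁻ z q q∈V z∈q)
      ... | inj₂ z∈v = disjoint v q v∈V q∈V (q≢v ∘ sym) z z∈v (β′-other⁻ z q q∈V z∈q)

      disjoint′ : ∀ p q → p ∈ᵗ Trigraph.V Tg′ → q ∈ᵗ Trigraph.V Tg′ → p ≢ q →
        ∀ z → z ∈ᵗ β′ p → z ∈ᵗ β′ q → ⊥
      disjoint′ p q p∈ q∈ p≢q z z∈p z∈q with ∈V-contract⁻ p p∈ | ∈V-contract⁻ q q∈
      ... | inj₁ refl | inj₁ refl = p≢q refl
      ... | inj₁ refl | inj₂ (q∈V , q≢u , q≢v) = disjoint-w q q∈V q≢u q≢v z z∈p z∈q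
      ... | inj₂ (p∈V , p≢u , p≢v) | inj₁ refl = disjoint-w p p∈V p≢u p≢v z z∈q z∈p
      ... | inj₂ (p∈V , _ , _) | inj₂ (q∈V , _ , _) =
        disjoint p q p∈V q∈V p≢q z (β′-other⁻ z p p∈V z∈p) (β′-other⁻ z q q∈V z∈q)

      homogeneous-w : ∀ q → q ∈ᵗ V → q ≢ u → q ≢ v →
        (black′ red′ : Bool) → black′ ≡ (black u q ∧ black v q) →
        red′ ≡ (red u q ∨ red v q ∨ (black u q ∧ not (black v q ∨ red v q))
                 ∨ (black v q ∧ not (black u q ∨ red u q))) →
        ∀ a c → a ∈ᵗ β′ w → c ∈ᵗ β q →
        (black′ ≡ true → GE a c ≡ true) × (black′ ≡ false → red′ ≡ false → GE a c ≡ false)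
      homogeneous-w q q∈V q≢u q≢v black′ red′ black-eq red-eq a c a∈w c∈q = black-case , non-case
        where
        black-case : black′ ≡ true → GE a c ≡ true
        black-case e with β′-w⁻ a a∈w
        ... | inj₁ a∈u = proj₁ (homogeneous u q u∈V q∈V (q≢u ∘ sym) a c a∈u c∈q) (∧-true⁻ˡ (trans (sym black-eq) e))
        ... | inj₂ a∈v = proj₁ (homogeneous v q v∈V q∈V (q≢v ∘ sym) a c a∈v c∈q)
                                 (∧-true⁻ʳ {black u q} (trans (sym black-eq) e))
        non-case : black′ ≡ false → red′ ≡ false → GE a c ≡ false
        non-case e₁ e₂ with merged-nonadjacent⇒parts-nonadjacent (black u q) (black v q) (red u q) (red v q)
                                  (trans (sym black-eq) e₁) (trans (sym red-eq) e₂)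
        ... | (bu , ru) , (bv , rv) with β′-w⁻ a a∈w
        ... | inj₁ a∈u = proj₂ (homogeneous u q u∈V q∈V (q≢u ∘ sym) a c a∈u c∈q) bu ru
        ... | inj₂ a∈v = proj₂ (homogeneous v q v∈V q∈V (q≢v ∘ sym) a c a∈v c∈q) bv rv

      transpose : ∀ {a c} {b r : Bool} → (b ≡ true → GE c a ≡ true) × (b ≡ false → r ≡ false → GE c a ≡ false) →
        (b ≡ true → GE a c ≡ true) × (b ≡ false → r ≡ false → GE a c ≡ false)
      transpose {a} {c} (h₁ , h₂) = (λ e → trans (GE-sym a c) (h₁ e)) , (λ e₁ e₂ → trans (GE-sym a c) (h₂ e₁ e₂))

      homogeneous′ : ∀ p q → p ∈ᵗ Trigraph.V Tg′ → q ∈ᵗ Trigraph.V Tg′ → p ≢ q →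
        ∀ a c → a ∈ᵗ β′ p → c ∈ᵗ β′ q →
        (Trigraph.black Tg′ p q ≡ true → GE a c ≡ true)
        × (Trigraph.black Tg′ p q ≡ false → Trigraph.red Tg′ p q ≡ false → GE a c ≡ false)
      homogeneous′ p q p∈ q∈ p≢q a c a∈p c∈q with ∈V-contract⁻ p p∈ | ∈V-contract⁻ q q∈
      ... | inj₁ refl | inj₁ refl = ⊥-elim (p≢q refl)
      ... | inj₁ refl | inj₂ (q∈V , q≢u , q≢v) =
        homogeneous-w q q∈V q≢u q≢v _ _ (proj₁ (edges-from-w q q∈ p≢q)) (proj₂ (edges-from-w q q∈ p≢q))
                      a c a∈p (β′-other⁻ c q q∈V c∈q)
      ... | inj₂ (p∈V , p≢u , p≢v) | inj₁ refl = transpose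
        (homogeneous-w p p∈V p≢u p≢v _ _ (proj₁ (edges-to-w p p∈ p≢q)) (proj₂ (edges-to-w p p∈ p≢q))
                       c a c∈q (β′-other⁻ a p p∈V a∈p))
      ... | inj₂ (p∈V , _ , _) | inj₂ (q∈V , _ , _)
        with edges-away-from-w p q p∈ q∈ p≢q (V⇒≢w p∈V) (V⇒≢w q∈V)
      ... | black≡ , red≡ rewrite black≡ | red≡ =
        homogeneous p q p∈V q∈V p≢q a c (β′-other⁻ a p p∈V a∈p) (β′-other⁻ c q q∈V c∈q)

      homogeneousBags-contract : HomogeneousBags Tg′ β′
      homogeneousBags-contract = record { disjoint = disjoint′ ; homogeneous = homogeneous′ }

  homogeneousBags-prefix : ∀ n steps Tg β → HomogeneousBags Tg β → ValidSeq Tg steps →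
    HomogeneousBags (applySteps Tg (take n steps)) (bagAfter β (take n steps))
  homogeneousBags-prefix zero    steps              Tg β hb _ = hb
  homogeneousBags-prefix (suc n) []                 Tg β hb _ = hb
  homogeneousBags-prefix (suc n) ((u , v , w) ∷ steps) Tg β hb (valid , rest) =
    homogeneousBags-prefix n steps (contract Tg u v w) (Contraction.β′ Tg β u v w)
      (Contraction.Preserved.homogeneousBags-contract Tg β u v w hb valid) rest

  bag-search : ∀ {Tg β} → HomogeneousBags Tg β → (L : List ℕ) → (∀ a → a ∈ᵗ L → a ∈ᵗ Trigraph.V Tg) →
    ∀ u t (g : ℕ → Bool) → t ∈ᵗ L → u ∈ᵗ β t → any (λ t′ → (u ∈ᵇ β t′) ∧ g t′) L ≡ g t
  bag-search hb L L⊆V u t g t∈ u∈ = any-guarded g L (∈ᵗ⇒∈ t L t∈) u∈ λ t′ t′∈ t′≢t →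
    ¬-not (λ u∈′ → HomogeneousBags.disjoint hb t′ t (L⊆V t′ (∈⇒∈ᵗ t′∈)) (L⊆V t t∈) t′≢t u u∈′ u∈)

∈βset⁺ : ∀ {G} (S : ContrSeq G) l X t → t ∈ᵗ X → ∀ z → z ∈ᵗ βat S l t → z ∈ᵗ βset S l X
∈βset⁺ S l X t t∈ z z∈ = ∈⇒∈ᵗ (∈-concatMap⁺ (βat S l) (lose (∈ᵗ⇒∈ t X t∈) (∈ᵗ⇒∈ z (βat S l t) z∈)))

∈βset⁻ : ∀ {G} (S : ContrSeq G) l X z → z ∈ᵗ βset S l X → Σ ℕ (λ t → t ∈ᵗ X × z ∈ᵗ βat S l t)
∈βset⁻ S l X z e with find (∈-concatMap⁻ (βat S l) {xs = X} (∈ᵗ⇒∈ z _ e))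
... | t , t∈ , z∈ = t , ∈⇒∈ᵗ t∈ , ∈⇒∈ᵗ z∈

record StepAt (Tg : Trigraph) (β : ℕ → List ℕ) (steps : List Step) (n u₁ u₂ v : ℕ) : Set where
  field
    valid : ValidStep (applySteps Tg (take n steps)) (u₁ , u₂ , v)
    vertices : Trigraph.V (applySteps Tg (take (suc n) steps))
             ≡ Trigraph.V (contract (applySteps Tg (take n steps)) u₁ u₂ v)
    bags : ∀ z → bagAfter β (take (suc n) steps) z
                 ≡ (if z ≡ᵇ v then bagAfter β (take n steps) u₁ ++ bagAfter β (take n steps) u₂
                    else bagAfter β (take n steps) z)

stepAt-prefix : ∀ n steps Tg β {u₁ u₂ v} → nth steps n ≡ just (u₁ , u₂ , v) → ValidSeq Tg steps →
  StepAt Tg β steps n u₁ u₂ v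
stepAt-prefix zero (_ ∷ _) Tg β refl (valid , _) =
  record { valid = valid ; vertices = refl ; bags = λ _ → refl }
stepAt-prefix (suc n) ((a , c , w) ∷ steps) Tg β e (_ , rest) =
  record { valid = valid ; vertices = vertices ; bags = bags }
  where open StepAt (stepAt-prefix n steps (contract Tg a c w) (λ p → if p ≡ᵇ w then β a ++ β c else β p) e rest)

evalQF-cong : ∀ {k} (adj adj′ : Node → Node → Bool) (ρ ρ′ : Var k → Node) →
  (∀ A B → eqN (ρ A) (ρ B) ≡ eqN (ρ′ A) (ρ′ B)) → (∀ A B → adj (ρ A) (ρ B) ≡ adj′ (ρ′ A) (ρ′ B)) →
  ∀ φ → evalQF adj ρ φ ≡ evalQF adj′ ρ′ φ
evalQF-cong adj adj′ ρ ρ′ eqs adjs = go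
  where
  go : ∀ φ → evalQF adj ρ φ ≡ evalQF adj′ ρ′ φ
  go tt = refl
  go ff = refl
  go (eq A B) = eqs A B
  go (edge A B) = adjs A B
  go (neg φ) = cong not (go φ)
  go (and φ χ) = cong₂ _∧_ (go φ) (go χ)
  go (or φ χ) = cong₂ _∨_ (go φ) (go χ)

bigOplus-entry : ∀ {k} m (πs : Fin (suc m) → VData k) ss (a : Fin k) →
  ∃ λ j → bigOplus m πs ss a ≡ ss j a
        × (inD (πs j) (VData.f (πs j) a) ≡ true ⊎ (∀ l → inD (πs l) (VData.f (πs l) a) ≡ false))
bigOplus-entry zero πs ss a with inD (πs Fin.zero) (VData.f (πs Fin.zero) a) in e
... | true  = Fin.zero , refl , inj₁ e
... | false = Fin.zero , refl , inj₂ (λ { Fin.zero → e })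
bigOplus-entry (suc m) πs ss a with inD (πs Fin.zero) (VData.f (πs Fin.zero) a) in e
... | true  = Fin.zero , refl , inj₁ e
... | false with bigOplus-entry m (πs ∘ Fin.suc) (ss ∘ Fin.suc) a
... | j , s≡ , inj₁ owned = Fin.suc j , s≡ , inj₁ owned
... | j , s≡ , inj₂ unowned = Fin.suc j , s≡ , inj₂ (λ { Fin.zero → e ; (Fin.suc l) → unowned l })

module Decomposition (G : Graph) (S : ContrSeq G) (d k p : ℕ) (ψ : Fin p → QF k) (n : ℕ)
  (u₁ u₂ v : ℕ) (contraction : stepAt S (suc (suc n)) ≡ just (u₁ , u₂ , v))
  (H : LGraph k) (π : VData k) (π-virtual : IsVirtualProfile S k d (suc (suc n)) H π)
  (f′ : Fin k → Node) (f′-compatible : Compatible π u₁ u₂ v f′)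
  (m : ℕ) (πs : Fin (suc m) → VData k) (decomposition : FDecomp S k d (suc (suc n)) H π u₁ u₂ v f′ (suc m) πs)
  (ss : Fin (suc m) → Fin k → Node) (solutions : ∀ j → Solution S (suc n) H (πs j) (ss j)) where

  open Graph G using () renaming (E to GE; sym to GE-sym)
  open VData π using () renaming (T to Tπ; D to Dπ; 𝒱 to 𝒱π; 𝓔 to 𝓔π; f to fπ)

  i : ℕ
  i = suc (suc n)

  Piece : Set
  Piece = Fin (suc m)

  Tj Dj : Piece → List ℕ
  Tj j = VData.T (πs j)
  Dj j = VData.D (πs j)

  𝓔j : Piece → Node → Node → Bool
  𝓔j j = VData.𝓔 (πs j)

  fj : Piece → Fin k → Node
  fj j = VData.f (πs j)

  h : Fin k → ℕ
  h = LGraph.h H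

  Gᵢ₋₁ Gᵢ : Trigraph
  Gᵢ₋₁ = Gat S (suc n)
  Gᵢ = Gat S i

  βᵢ₋₁ βᵢ : ℕ → List ℕ
  βᵢ₋₁ = βat S (suc n)
  βᵢ = βat S i

  Tπ′ Dπ′ : List ℕ
  Tπ′ = T' Tπ u₁ u₂ v
  Dπ′ = D' Tπ u₁ u₂ v f′

  s : Fin k → Node
  s = bigOplus m πs ss

  Tπ-unique : Unique Tπ
  Tπ-unique = let ((U , _) , _) = π-virtual in U

  Tπ⊆Vᵢ : ∀ a → a ∈ᵗ Tπ → a ∈ᵗ Trigraph.V Gᵢ
  Tπ⊆Vᵢ = let ((_ , T⊆V , _) , _) = π-virtual in T⊆V

  Dπ⊆Tπ : ∀ a → a ∈ᵗ Dπ → a ∈ᵗ Tπ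
  Dπ⊆Tπ = let ((_ , _ , _ , _ , _ , D⊆T , _) , _) = π-virtual in D⊆T

  𝓔π-sym : ∀ p q → 𝓔π p q ≡ 𝓔π q p
  𝓔π-sym = let (_ , _ , _ , E-sym , _) = π-virtual in E-sym

  𝓔π-support : ∀ p q → 𝓔π p q ≡ true →
    p ≢ q × ((inTV Tπ 𝒱π p ≡ true × isVirt 𝒱π q ≡ true) ⊎ (isVirt 𝒱π p ≡ true × inTV Tπ 𝒱π q ≡ true))
  𝓔π-support = let (_ , _ , _ , _ , E-support , _) = π-virtual in E-support

  fπ-range : ∀ a → inTV Dπ 𝒱π (fπ a) ≡ true
  fπ-range = let (_ , _ , _ , _ , _ , range , _) = π-virtual in range

  fπ-onto : ∀ z → inTV Dπ 𝒱π z ≡ true → Σ (Fin k) (λ a → fπ a ≡ z)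
  fπ-onto = let (_ , _ , _ , _ , _ , _ , onto , _) = π-virtual in onto

  v∈Tπ : v ∈ᵗ Tπ
  v∈Tπ = let (v∈T , _) = decomposition in v∈T

  πs-virtual : ∀ j → IsVirtualProfile S k d (suc n) H (πs j)
  πs-virtual = let (_ , virtual , _) = decomposition in virtual

  Tj-disjoint : ∀ j l → j ≢ l → ∀ a → a ∈ᵗ Tj j → a ∈ᵗ Tj l → ⊥
  Tj-disjoint = let (_ , _ , (disjoint , _) , _) = decomposition in disjoint

  Tπ′-covered : ∀ a → a ∈ᵗ Tπ′ ⇔ Σ Piece (λ j → a ∈ᵗ Tj j)
  Tπ′-covered = let (_ , _ , (_ , cover , _) , _) = decomposition in cover

  Dπ′-covered : ∀ a → a ∈ᵗ Dπ′ ⇔ Σ Piece (λ j → a ∈ᵗ Dj j)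
  Dπ′-covered = let (_ , _ , (_ , _ , cover , _) , _) = decomposition in cover

  no-red-to-other-D : ∀ j l → j ≢ l → ∀ a b → a ∈ᵗ Tj j → b ∈ᵗ Dj l → Trigraph.red Gᵢ₋₁ a b ≡ false
  no-red-to-other-D = let (_ , _ , (_ , _ , _ , _ , no-red) , _) = decomposition in no-red

  fj-spec : ∀ j a → (inTV (Dj j) 𝒱π (f′ a) ≡ true → fj j a ≡ f′ a)
                  × (∀ w → f′ a ≡ inj₁ w → w ∈ᵗ Dπ′ → (w ∈ᵇ Dj j) ≡ false → fj j a ≡ inj₂ (h a))
  fj-spec j = let (_ , _ , _ , spec) = decomposition ; (_ , f-spec , _) = spec j in f-spec

  𝓔j-spec : ∀ j p q → 𝓔j j p q ≡ true ⇔ (EjGen S i H π u₁ u₂ v f′ (Tj j) (Dj j) p q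
                                          ⊎ EjGen S i H π u₁ u₂ v f′ (Tj j) (Dj j) q p)
  𝓔j-spec j = let (_ , _ , _ , spec) = decomposition ; (_ , _ , E-spec) = spec j in E-spec

  Tj-unique : ∀ j → Unique (Tj j)
  Tj-unique j = let ((U , _) , _) = πs-virtual j in U

  Tj⊆Vᵢ₋₁ : ∀ j a → a ∈ᵗ Tj j → a ∈ᵗ Trigraph.V Gᵢ₋₁
  Tj⊆Vᵢ₋₁ j = let ((_ , T⊆V , _) , _) = πs-virtual j in T⊆V

  Dj⊆Tj : ∀ j a → a ∈ᵗ Dj j → a ∈ᵗ Tj j
  Dj⊆Tj j = let ((_ , _ , _ , _ , _ , D⊆T , _) , _) = πs-virtual j in D⊆T

  sj-virtual : ∀ j a o → fj j a ≡ inj₂ o → ss j a ≡ inj₂ o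
  sj-virtual j = let (_ , virtual , _) = solutions j in virtual

  sj-bag : ∀ j a u → fj j a ≡ inj₁ u → Σ ℕ (λ z → ss j a ≡ inj₁ z × z ∈ᵗ βᵢ₋₁ u)
  sj-bag j = let (_ , _ , bag , _) = solutions j in bag

  sj-≡⇒h-≡ : ∀ j a b → ss j a ≡ ss j b → h a ≡ h b
  sj-≡⇒h-≡ j = let (_ , _ , _ , well-defined , _) = solutions j in well-defined

  h-≡⇒sj-≡ : ∀ j a b → h a ≡ h b → ss j a ≡ ss j b
  h-≡⇒sj-≡ j = let (_ , _ , _ , _ , injective , _) = solutions j in injective

  sj-adj : ∀ j a b → adjGπ S (suc n) (πs j) (ss j a) (ss j b) ≡ LGraph.E H (h a) (h b)
  sj-adj j = let (_ , _ , _ , _ , _ , adj) = solutions j in adj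

  bagsᵢ₋₁ : HomogeneousBags G Gᵢ₋₁ βᵢ₋₁
  bagsᵢ₋₁ = homogeneousBags-prefix G n (ContrSeq.steps S) (toTrigraph G) (λ z → z ∷ [])
              (homogeneousBags-initial G) (ContrSeq.valid S)

  bagsᵢ : HomogeneousBags G Gᵢ βᵢ
  bagsᵢ = homogeneousBags-prefix G (suc n) (ContrSeq.steps S) (toTrigraph G) (λ z → z ∷ [])
            (homogeneousBags-initial G) (ContrSeq.valid S)

  open StepAt (stepAt-prefix n (ContrSeq.steps S) (toTrigraph G) (λ z → z ∷ []) contraction (ContrSeq.valid S))
    renaming (valid to step-valid; vertices to step-vertices; bags to step-bags)

  u₁≢u₂ : u₁ ≢ u₂
  u₁≢u₂ = let (≢ , _) = step-valid in ≢

  u₁∈Vᵢ₋₁ : u₁ ∈ᵗ Trigraph.V Gᵢ₋₁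
  u₁∈Vᵢ₋₁ = let (_ , u₁∈ , _) = step-valid in u₁∈

  u₂∈Vᵢ₋₁ : u₂ ∈ᵗ Trigraph.V Gᵢ₋₁
  u₂∈Vᵢ₋₁ = let (_ , _ , u₂∈ , _) = step-valid in u₂∈

  v∉Vᵢ₋₁ : v ∈ᵗ Trigraph.V Gᵢ₋₁ → ⊥
  v∉Vᵢ₋₁ v∈ = let (_ , _ , _ , v∉) = step-valid in ≡true⇒≢false v∈ v∉

  ∈Vᵢ⁻ : ∀ z → z ∈ᵗ Trigraph.V Gᵢ → z ≡ v ⊎ (z ∈ᵗ Trigraph.V Gᵢ₋₁ × z ≢ u₁ × z ≢ u₂)
  ∈Vᵢ⁻ z e = Contraction.∈V-contract⁻ G Gᵢ₋₁ βᵢ₋₁ u₁ u₂ v z (subst (z ∈ᵗ_) step-vertices e)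

  βᵢ-v : βᵢ v ≡ βᵢ₋₁ u₁ ++ βᵢ₋₁ u₂
  βᵢ-v = trans (step-bags v) (cong (λ b → if b then βᵢ₋₁ u₁ ++ βᵢ₋₁ u₂ else βᵢ₋₁ v) (≡ᵇ-refl v))

  βᵢ-other : ∀ {z} → z ≢ v → βᵢ z ≡ βᵢ₋₁ z
  βᵢ-other {z} z≢v = trans (step-bags z) (cong (λ b → if b then βᵢ₋₁ u₁ ++ βᵢ₋₁ u₂ else βᵢ₋₁ z) (≢⇒≡ᵇ-false z≢v))

  Tπ∩Vᵢ₋₁⇒≢u : ∀ {u} → u ∈ᵗ Trigraph.V Gᵢ₋₁ → u ∈ᵗ Tπ → u ≢ u₁ × u ≢ u₂
  Tπ∩Vᵢ₋₁⇒≢u {u} u∈Vᵢ₋₁ u∈Tπ with ∈Vᵢ⁻ u (Tπ⊆Vᵢ u u∈Tπ)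
  ... | inj₁ refl = ⊥-elim (v∉Vᵢ₋₁ u∈Vᵢ₋₁)
  ... | inj₂ (_ , ≢u₁ , ≢u₂) = ≢u₁ , ≢u₂

  u₁∉Tπ : u₁ ∈ᵗ Tπ → ⊥
  u₁∉Tπ u₁∈ = proj₁ (Tπ∩Vᵢ₋₁⇒≢u u₁∈Vᵢ₋₁ u₁∈) refl

  u₂∉Tπ : u₂ ∈ᵗ Tπ → ⊥
  u₂∉Tπ u₂∈ = proj₂ (Tπ∩Vᵢ₋₁⇒≢u u₂∈Vᵢ₋₁ u₂∈) refl

  rm-v : List ℕ → List ℕ
  rm-v = filterᵇ (λ a → not (a ≡ᵇ v))

  ∈-rm-v⁻ : ∀ {t L} → t ∈ rm-v L → t ∈ L × t ≢ v
  ∈-rm-v⁻ {t} {L} t∈ with ∈-filterᵇ⁻ (λ a → not (a ≡ᵇ v)) L t∈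
  ... | t∈L , t≢ᵇv = t∈L , ≡ᵇ-false⇒≢ (not-true⇒false t≢ᵇv)

  ∈-rm-v⁺ : ∀ {t L} → t ∈ L → t ≢ v → t ∈ rm-v L
  ∈-rm-v⁺ t∈L t≢v = ∈-filterᵇ⁺ (λ a → not (a ≡ᵇ v)) t∈L (cong not (≢⇒≡ᵇ-false t≢v))

  ∈Tπ′⁻ : ∀ t → t ∈ᵗ Tπ′ → (t ≡ u₁ ⊎ t ≡ u₂) ⊎ (t ∈ᵗ Tπ × t ≢ v × t ≢ u₁ × t ≢ u₂)
  ∈Tπ′⁻ t e with ∈ᵗ⇒∈ t Tπ′ e
  ... | here t≡u₁ = inj₁ (inj₁ t≡u₁)
  ... | there (here t≡u₂) = inj₁ (inj₂ t≡u₂)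
  ... | there (there t∈) with ∈-rm-v⁻ {t} {Tπ} t∈
  ... | t∈Tπ , t≢v = inj₂ (∈⇒∈ᵗ t∈Tπ , t≢v , (λ { refl → u₁∉Tπ (∈⇒∈ᵗ t∈Tπ) }) , (λ { refl → u₂∉Tπ (∈⇒∈ᵗ t∈Tπ) }))

  u₁∈Tπ′ : u₁ ∈ᵗ Tπ′
  u₁∈Tπ′ = ∈⇒∈ᵗ {u₁} {Tπ′} (here refl)

  u₂∈Tπ′ : u₂ ∈ᵗ Tπ′
  u₂∈Tπ′ = ∈⇒∈ᵗ {u₂} {Tπ′} (there (here refl))

  Tπ-other⊆Tπ′ : ∀ {t} → t ∈ᵗ Tπ → t ≢ v → t ∈ᵗ Tπ′
  Tπ-other⊆Tπ′ {t} t∈ t≢v = ∈⇒∈ᵗ {t} {Tπ′} (there (there (∈-rm-v⁺ (∈ᵗ⇒∈ t Tπ t∈) t≢v)))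

  Tπ′-unique : Unique Tπ′
  Tπ′-unique = All.tabulate u₁≢ ∷ All.tabulate u₂≢ ∷ Unique.filter⁺ _ Tπ-unique
    where
    u₁≢ : ∀ {t} → t ∈ u₂ ∷ rm-v Tπ → u₁ ≢ t
    u₁≢ (here refl) = u₁≢u₂
    u₁≢ (there t∈) refl = u₁∉Tπ (∈⇒∈ᵗ (proj₁ (∈-rm-v⁻ {L = Tπ} t∈)))
    u₂≢ : ∀ {t} → t ∈ rm-v Tπ → u₂ ≢ t
    u₂≢ t∈ refl = u₂∉Tπ (∈⇒∈ᵗ (proj₁ (∈-rm-v⁻ {L = Tπ} t∈)))

  Tj⊆Tπ′ : ∀ j a → a ∈ᵗ Tj j → a ∈ᵗ Tπ′
  Tj⊆Tπ′ j a e = from (Tπ′-covered a) (j , e)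

  Dπ′-intro : ∀ {w} b → w ∈ᵗ Tπ′ → f′ b ≡ inj₁ w → w ∈ᵗ Dπ′
  Dπ′-intro {w} b w∈ f′b≡w = ∈⇒∈ᵗ (∈-filterᵇ⁺ in-range (∈ᵗ⇒∈ w Tπ′ w∈) w-in-range)
    where
    in-range : ℕ → Bool
    in-range a = any (λ b → eqN (f′ b) (inj₁ a)) (allFin k)
    w-in-range : in-range w ≡ true
    w-in-range = any-true⁺ (∈-allFin b) (subst (λ q → eqN q (inj₁ w) ≡ true) (sym f′b≡w) (≡ᵇ-refl w))

  Dj-owner-unique : ∀ {w} j l → w ∈ᵗ Dj j → w ∈ᵗ Dj l → j ≡ l
  Dj-owner-unique {w} j l w∈j w∈l with j Fin.≟ l
  ... | yes j≡l = j≡l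
  ... | no j≢l = ⊥-elim (Tj-disjoint j l j≢l w (Dj⊆Tj j w w∈j) (Dj⊆Tj l w w∈l))

  βᵢ₋₁u₁⊆βᵢv : ∀ z → z ∈ᵗ βᵢ₋₁ u₁ → z ∈ᵗ βᵢ v
  βᵢ₋₁u₁⊆βᵢv z e = ∈⇒∈ᵗ (subst (z ∈_) (sym βᵢ-v) (∈-++⁺ˡ (∈ᵗ⇒∈ z (βᵢ₋₁ u₁) e)))

  βᵢ₋₁u₂⊆βᵢv : ∀ z → z ∈ᵗ βᵢ₋₁ u₂ → z ∈ᵗ βᵢ v
  βᵢ₋₁u₂⊆βᵢv z e = ∈⇒∈ᵗ (subst (z ∈_) (sym βᵢ-v) (∈-++⁺ʳ (βᵢ₋₁ u₁) (∈ᵗ⇒∈ z (βᵢ₋₁ u₂) e)))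

  βᵢ₋₁⊆βᵢ-other : ∀ z t → t ≢ v → z ∈ᵗ βᵢ₋₁ t → z ∈ᵗ βᵢ t
  βᵢ₋₁⊆βᵢ-other z t t≢v e = subst (z ∈ᵗ_) (sym (βᵢ-other t≢v)) e

  βᵢ₋₁⊆βsetᵢ : ∀ t → t ∈ᵗ Tπ′ → ∀ z → z ∈ᵗ βᵢ₋₁ t → z ∈ᵗ βset S i Tπ
  βᵢ₋₁⊆βsetᵢ t t∈ z z∈ with ∈Tπ′⁻ t t∈
  ... | inj₁ (inj₁ refl) = ∈βset⁺ S i Tπ v v∈Tπ z (βᵢ₋₁u₁⊆βᵢv z z∈)
  ... | inj₁ (inj₂ refl) = ∈βset⁺ S i Tπ v v∈Tπ z (βᵢ₋₁u₂⊆βᵢv z z∈)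
  ... | inj₂ (t∈Tπ , t≢v , _) = ∈βset⁺ S i Tπ t t∈Tπ z (βᵢ₋₁⊆βᵢ-other z t t≢v z∈)

  βsetj⊆βsetᵢ : ∀ j z → z ∈ᵗ βset S (suc n) (Tj j) → z ∈ᵗ βset S i Tπ
  βsetj⊆βsetᵢ j z e with ∈βset⁻ S (suc n) (Tj j) z e
  ... | t , t∈ , z∈ = βᵢ₋₁⊆βsetᵢ t (Tj⊆Tπ′ j t t∈) z z∈

  bag-searchᵢ : ∀ u t (g : ℕ → Bool) → t ∈ᵗ Tπ → u ∈ᵗ βᵢ t → any (λ t′ → (u ∈ᵇ βᵢ t′) ∧ g t′) Tπ ≡ g t
  bag-searchᵢ = bag-search G bagsᵢ Tπ Tπ⊆Vᵢ

  bag-searchᵢ₋₁ : ∀ j u t (g : ℕ → Bool) → t ∈ᵗ Tj j → u ∈ᵗ βᵢ₋₁ t →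
    any (λ t′ → (u ∈ᵇ βᵢ₋₁ t′) ∧ g t′) (Tj j) ≡ g t
  bag-searchᵢ₋₁ j = bag-search G bagsᵢ₋₁ (Tj j) (Tj⊆Vᵢ₋₁ j)

  f′-agrees : ∀ {a q} → fπ a ≡ q → q ≢ inj₁ v → f′ a ≡ q
  f′-agrees {a} fπa≡q q≢v = trans (proj₂ (f′-compatible a) (λ fπa≡v → q≢v (trans (sym fπa≡q) fπa≡v))) fπa≡q

  record Owner (a : Fin k) (w : ℕ) : Set where
    field
      f′≡w : f′ a ≡ inj₁ w
      w∈D′ : w ∈ᵗ Dπ′
      piece : Piece
      w∈D : w ∈ᵗ Dj piece
      point : ℕ
      s-piece : ss piece a ≡ inj₁ point
      point∈bag : point ∈ᵗ βᵢ₋₁ w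
      f-piece : fj piece a ≡ inj₁ w
      f-elsewhere : ∀ j → j ≢ piece → fj j a ≡ inj₂ (h a)
      s-elsewhere : ∀ j → j ≢ piece → ss j a ≡ inj₂ (h a)

    w∈T : w ∈ᵗ Tj piece
    w∈T = Dj⊆Tj piece w w∈D

    point∈βset : point ∈ᵗ βset S (suc n) (Tj piece)
    point∈βset = ∈βset⁺ S (suc n) (Tj piece) w w∈T point point∈bag

    point∈βsetᵢ : point ∈ᵗ βset S i Tπ
    point∈βsetᵢ = βᵢ₋₁⊆βsetᵢ w (Tj⊆Tπ′ piece w w∈T) point point∈bag

  owner : ∀ a w → f′ a ≡ inj₁ w → w ∈ᵗ Dπ′ → Owner a w
  owner a w f′a≡w w∈D′ = record
    { f′≡w = f′a≡w ; w∈D′ = w∈D′ ; piece = J ; w∈D = w∈DJ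
    ; point = proj₁ bag ; s-piece = proj₁ (proj₂ bag) ; point∈bag = proj₂ (proj₂ bag)
    ; f-piece = f-piece ; f-elsewhere = f-elsewhere
    ; s-elsewhere = λ j j≢J → sj-virtual j a (h a) (f-elsewhere j j≢J) }
    where
    J = proj₁ (to (Dπ′-covered w) w∈D′)
    w∈DJ = proj₂ (to (Dπ′-covered w) w∈D′)
    f-piece : fj J a ≡ inj₁ w
    f-piece = trans (proj₁ (fj-spec J a) (subst (λ q → inTV (Dj J) 𝒱π q ≡ true) (sym f′a≡w) w∈DJ)) f′a≡w
    bag = sj-bag J a w f-piece
    f-elsewhere : ∀ j → j ≢ J → fj j a ≡ inj₂ (h a)
    f-elsewhere j j≢J = proj₂ (fj-spec j a) w f′a≡w w∈D′
      (¬-not (λ w∈Dj → j≢J (Dj-owner-unique {w} j J w∈Dj w∈DJ)))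

  data IndexKind (a : Fin k) : Set where
    real    : ∀ {w} → Owner a w → IndexKind a
    virtual : (o : ℕ) → f′ a ≡ inj₂ o → o ∈ᵗ 𝒱π → IndexKind a

  indexKind : ∀ a → IndexKind a
  indexKind a = classify (fπ a) refl (fπ-range a)
    where
    real-at : ∀ {w} → w ∈ᵗ Tπ′ → f′ a ≡ inj₁ w → IndexKind a
    real-at {w} w∈ f′a≡w = real (owner a w f′a≡w (Dπ′-intro a w∈ f′a≡w))
    classify : (q : Node) → fπ a ≡ q → inTV Dπ 𝒱π q ≡ true → IndexKind a
    classify (inj₂ o) fπa≡o o∈ = virtual o (f′-agrees fπa≡o λ ()) o∈
    classify (inj₁ u) fπa≡u u∈ with u ≟ v
    ... | yes refl with proj₁ (f′-compatible a) fπa≡u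
    ...   | inj₁ f′a≡u₁ = real-at u₁∈Tπ′ f′a≡u₁
    ...   | inj₂ f′a≡u₂ = real-at u₂∈Tπ′ f′a≡u₂
    classify (inj₁ u) fπa≡u u∈ | no u≢v =
      real-at (Tπ-other⊆Tπ′ (Dπ⊆Tπ u u∈) u≢v) (f′-agrees fπa≡u (u≢v ∘ inj₁-injective))

  sj-virtual-index : ∀ a o → f′ a ≡ inj₂ o → o ∈ᵗ 𝒱π → ∀ j → ss j a ≡ inj₂ o
  sj-virtual-index a o f′a≡o o∈ j =
    sj-virtual j a o (trans (proj₁ (fj-spec j a) (subst (λ q → inTV (Dj j) 𝒱π q ≡ true) (sym f′a≡o) o∈)) f′a≡o)

  s-virtual : ∀ a o → f′ a ≡ inj₂ o → o ∈ᵗ 𝒱π → s a ≡ inj₂ o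
  s-virtual a o f′a≡o o∈ with bigOplus-entry m πs ss a
  ... | j , s≡sj , _ = trans s≡sj (sj-virtual-index a o f′a≡o o∈ j)

  sj≡s-virtual : ∀ a o → f′ a ≡ inj₂ o → o ∈ᵗ 𝒱π → ∀ j → ss j a ≡ s a
  sj≡s-virtual a o f′a≡o o∈ j = trans (sj-virtual-index a o f′a≡o o∈ j) (sym (s-virtual a o f′a≡o o∈))

  s-owned : ∀ {a w} (O : Owner a w) → s a ≡ ss (Owner.piece O) a
  s-owned {a} O with bigOplus-entry m πs ss a
  ... | j , s≡sj , inj₂ unowned =
    ⊥-elim (≡true⇒≢false (subst (λ q → inD (πs J) q ≡ true) (sym (Owner.f-piece O)) (Owner.w∈D O)) (unowned J))
    where J = Owner.piece O
  ... | j , s≡sj , inj₁ j-owns with j Fin.≟ Owner.piece O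
  ...   | yes refl = s≡sj
  ...   | no j≢J = ⊥-elim (≡true⇒≢false (subst (λ q → inD (πs j) q ≡ true) (Owner.f-elsewhere O j j≢J) j-owns) refl)

  s-point : ∀ {a w} (O : Owner a w) → s a ≡ inj₁ (Owner.point O)
  s-point O = trans (s-owned O) (Owner.s-piece O)

  virtual-preimage : ∀ o → o ∈ᵗ 𝒱π → Σ (Fin k) (λ b → f′ b ≡ inj₂ o)
  virtual-preimage o o∈ with fπ-onto (inj₂ o) o∈
  ... | b , fπb≡o = b , f′-agrees fπb≡o λ ()

  -- If h c were a virtual vertex o = f′ b of π, the pieces not owning c would map both b and c to o,
  -- forcing h b = h c; the owning piece would then map c to o as well, not to a vertex of G.
  label-not-virtual-of-owner : ∀ {c w} (O : Owner c w) j → j ≢ Owner.piece O → h c ∈ᵗ 𝒱π → ⊥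
  label-not-virtual-of-owner {c} O j j≢J hc∈ with virtual-preimage (h c) hc∈
  ... | b , f′b≡hc = inj₁≢inj₂ (trans (sym (Owner.s-piece O)) (trans sJc≡sJb (sj-virtual-index b (h c) f′b≡hc hc∈ J)))
    where
    J = Owner.piece O
    hc≡hb : h c ≡ h b
    hc≡hb = sj-≡⇒h-≡ j c b (trans (Owner.s-elsewhere O j j≢J) (sym (sj-virtual-index b (h c) f′b≡hc hc∈ j)))
    sJc≡sJb : ss J c ≡ ss J b
    sJc≡sJb = h-≡⇒sj-≡ J c b hc≡hb

  label-not-virtual : ∀ j c w → f′ c ≡ inj₁ w → w ∈ᵗ Dπ′ → (w ∈ᵇ Dj j) ≡ false → h c ∈ᵗ 𝒱π → ⊥
  label-not-virtual j c w f′c≡w w∈D′ w∉Dj =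
    label-not-virtual-of-owner O j (λ { refl → ≡true⇒≢false (Owner.w∈D O) w∉Dj })
    where O = owner c w f′c≡w w∈D′

  𝓔π-no-real-edges : ∀ a b → 𝓔π (inj₁ a) (inj₁ b) ≡ false
  𝓔π-no-real-edges a b = ¬-not λ e → case (proj₂ (𝓔π-support (inj₁ a) (inj₁ b) e))
    where
    case : (inTV Tπ 𝒱π (inj₁ a) ≡ true × false ≡ true) ⊎ (false ≡ true × inTV Tπ 𝒱π (inj₁ b) ≡ true) → ⊥
    case (inj₁ (_ , ()))
    case (inj₂ (() , _))

  𝓔π-outside-Tπ : ∀ a o → (a ∈ᵗ Tπ → ⊥) → 𝓔π (inj₁ a) (inj₂ o) ≡ false
  𝓔π-outside-Tπ a o a∉ = ¬-not λ e → a∉ (in-Tπ (proj₂ (𝓔π-support (inj₁ a) (inj₂ o) e)))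
    where
    in-Tπ : (a ∈ᵗ Tπ × o ∈ᵗ 𝒱π) ⊎ (false ≡ true × o ∈ᵗ 𝒱π) → a ∈ᵗ Tπ
    in-Tπ (inj₁ (a∈ , _)) = a∈
    in-Tπ (inj₂ (() , _))

  𝓔′ : Node → Node → Bool
  𝓔′ = 𝓔' π u₁ u₂ v

  𝓔′-sym : Node → Node → Bool
  𝓔′-sym p q = 𝓔′ p q ∨ 𝓔′ q p

  𝓔′-u₁ : ∀ o → (𝓔′ (inj₁ u₁) (inj₂ o) ≡ 𝓔π (inj₁ v) (inj₂ o)) × (𝓔′ (inj₂ o) (inj₁ u₁) ≡ 𝓔π (inj₂ o) (inj₁ v))
  𝓔′-u₁ o rewrite 𝓔π-outside-Tπ u₁ o u₁∉Tπ | trans (𝓔π-sym (inj₂ o) (inj₁ u₁)) (𝓔π-outside-Tπ u₁ o u₁∉Tπ)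
                | ≡ᵇ-refl u₁ = ∨-identityʳ _ , refl

  𝓔′-u₂ : ∀ o → (𝓔′ (inj₁ u₂) (inj₂ o) ≡ 𝓔π (inj₁ v) (inj₂ o)) × (𝓔′ (inj₂ o) (inj₁ u₂) ≡ 𝓔π (inj₂ o) (inj₁ v))
  𝓔′-u₂ o rewrite 𝓔π-outside-Tπ u₂ o u₂∉Tπ | trans (𝓔π-sym (inj₂ o) (inj₁ u₂)) (𝓔π-outside-Tπ u₂ o u₂∉Tπ)
                | ≢⇒≡ᵇ-false (u₁≢u₂ ∘ sym) | ≡ᵇ-refl u₂ = ∨-identityʳ _ , refl

  𝓔′-other : ∀ t o → t ∈ᵗ Tπ → t ≢ v → t ≢ u₁ → t ≢ u₂ → o ∈ᵗ 𝒱π →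
    (𝓔′ (inj₁ t) (inj₂ o) ≡ 𝓔π (inj₁ t) (inj₂ o)) × (𝓔′ (inj₂ o) (inj₁ t) ≡ 𝓔π (inj₂ o) (inj₁ t))
  𝓔′-other t o t∈ t≢v t≢u₁ t≢u₂ o∈ rewrite Tπ-other⊆Tπ′ t∈ t≢v | o∈ | ≢⇒≡ᵇ-false t≢u₁ | ≢⇒≡ᵇ-false t≢u₂ =
    ∧∨false _ , ∧∨false _
    where
    ∧∨false : ∀ b → (b ∧ true) ∨ false ≡ b
    ∧∨false b = trans (∨-identityʳ _) (∧-identityʳ b)

  𝓔′-virtual : ∀ o o′ → o ∈ᵗ 𝒱π → o′ ∈ᵗ 𝒱π → 𝓔′ (inj₂ o) (inj₂ o′) ≡ 𝓔π (inj₂ o) (inj₂ o′)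
  𝓔′-virtual o o′ o∈ o′∈ rewrite o∈ | o′∈ = trans (∨-identityʳ _) (∧-identityʳ _)

  𝓔′-no-real-edges : ∀ a b → 𝓔′ (inj₁ a) (inj₁ b) ≡ false
  𝓔′-no-real-edges a b rewrite 𝓔π-no-real-edges a b | 𝓔π-no-real-edges v b | 𝓔π-no-real-edges a v
    | ∧-zeroʳ ((a ≡ᵇ u₁) ∨ (a ≡ᵇ u₂)) | ∧-zeroʳ ((b ≡ᵇ u₁) ∨ (b ≡ᵇ u₂)) = refl

  𝓔j-real-virtual : ∀ j t o → t ∈ᵗ Tj j → o ∈ᵗ 𝒱π → 𝓔j j (inj₁ t) (inj₂ o) ≡ 𝓔′-sym (inj₁ t) (inj₂ o)
  𝓔j-real-virtual j t o t∈ o∈ = bool-ext to′ from′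
    where
    to′ : 𝓔j j (inj₁ t) (inj₂ o) ≡ true → 𝓔′-sym (inj₁ t) (inj₂ o) ≡ true
    to′ e with to (𝓔j-spec j (inj₁ t) (inj₂ o)) e
    ... | inj₁ (inj₁ (e′ , _ , _)) = ∨-trueˡ _ e′
    ... | inj₁ (inj₂ (inj₁ (c , w , o≡hc , _ , f′c≡w , (w∈D′ , w∉Dj) , _))) =
      ⊥-elim (label-not-virtual j c w f′c≡w w∈D′ w∉Dj (subst (_∈ᵗ 𝒱π) (inj₂-injective o≡hc) o∈))
    ... | inj₁ (inj₂ (inj₂ (_ , _ , t≡h , _))) = ⊥-elim (inj₁≢inj₂ t≡h)
    ... | inj₂ (inj₁ (e′ , _ , _)) = ∨-trueʳ (𝓔′ (inj₁ t) (inj₂ o)) e′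
    ... | inj₂ (inj₂ (inj₁ (_ , _ , t≡h , _))) = ⊥-elim (inj₁≢inj₂ t≡h)
    ... | inj₂ (inj₂ (inj₂ (_ , _ , _ , t≡h , _))) = ⊥-elim (inj₁≢inj₂ t≡h)
    from′ : 𝓔′-sym (inj₁ t) (inj₂ o) ≡ true → 𝓔j j (inj₁ t) (inj₂ o) ≡ true
    from′ e with ∨-true⁻ {𝓔′ (inj₁ t) (inj₂ o)} e
    ... | inj₁ e′ = from (𝓔j-spec j (inj₁ t) (inj₂ o)) (inj₁ (inj₁ (e′ , t∈ , o∈)))
    ... | inj₂ e′ = from (𝓔j-spec j (inj₁ t) (inj₂ o)) (inj₂ (inj₁ (e′ , o∈ , t∈)))

  𝓔j-virtual-virtual : ∀ j o o′ → o ∈ᵗ 𝒱π → o′ ∈ᵗ 𝒱π → 𝓔j j (inj₂ o) (inj₂ o′) ≡ 𝓔′-sym (inj₂ o) (inj₂ o′)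
  𝓔j-virtual-virtual j o o′ o∈ o′∈ = bool-ext to′ from′
    where
    not-label : ∀ {c q} → (∃ λ w → f′ c ≡ inj₁ w × (w ∈ᵗ Dπ′ × (w ∈ᵇ Dj j) ≡ false)) → q ≡ h c → q ∈ᵗ 𝒱π → ⊥
    not-label {c} (w , f′c≡w , w∈D′ , w∉Dj) refl = label-not-virtual j c w f′c≡w w∈D′ w∉Dj
    to′ : 𝓔j j (inj₂ o) (inj₂ o′) ≡ true → 𝓔′-sym (inj₂ o) (inj₂ o′) ≡ true
    to′ e with to (𝓔j-spec j (inj₂ o) (inj₂ o′)) e
    ... | inj₁ (inj₁ (e′ , _ , _)) = ∨-trueˡ _ e′
    ... | inj₁ (inj₂ (inj₁ (c , w , o′≡hc , _ , f′c≡w , w∈ , _))) =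
      ⊥-elim (not-label (w , f′c≡w , w∈) (inj₂-injective o′≡hc) o′∈)
    ... | inj₁ (inj₂ (inj₂ (a , _ , o≡ha , _ , _ , real-a , _))) = ⊥-elim (not-label real-a (inj₂-injective o≡ha) o∈)
    ... | inj₂ (inj₁ (e′ , _ , _)) = ∨-trueʳ (𝓔′ (inj₂ o) (inj₂ o′)) e′
    ... | inj₂ (inj₂ (inj₁ (c , w , o≡hc , _ , f′c≡w , w∈ , _))) =
      ⊥-elim (not-label (w , f′c≡w , w∈) (inj₂-injective o≡hc) o∈)
    ... | inj₂ (inj₂ (inj₂ (a , _ , o′≡ha , _ , _ , real-a , _))) = ⊥-elim (not-label real-a (inj₂-injective o′≡ha) o′∈)
    from′ : 𝓔′-sym (inj₂ o) (inj₂ o′) ≡ true → 𝓔j j (inj₂ o) (inj₂ o′) ≡ true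
    from′ e with ∨-true⁻ {𝓔′ (inj₂ o) (inj₂ o′)} e
    ... | inj₁ e′ = from (𝓔j-spec j (inj₂ o) (inj₂ o′)) (inj₁ (inj₁ (e′ , o∈ , o′∈)))
    ... | inj₂ e′ = from (𝓔j-spec j (inj₂ o) (inj₂ o′)) (inj₂ (inj₁ (e′ , o′∈ , o∈)))

  same-label⇒same-owner : ∀ {c c′ w w′} (O : Owner c w) (O′ : Owner c′ w′) → h c ≡ h c′ →
    Owner.piece O′ ≡ Owner.piece O
  same-label⇒same-owner {c} {c′} O O′ hc≡hc′ with Owner.piece O′ Fin.≟ Owner.piece O
  ... | yes J′≡J = J′≡J
  ... | no J′≢J = ⊥-elim (inj₁≢inj₂ (trans (sym (Owner.s-piece O))
          (trans (h-≡⇒sj-≡ (Owner.piece O) c c′ hc≡hc′) (Owner.s-elsewhere O′ (Owner.piece O) (J′≢J ∘ sym)))))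

  same-label⇒same-point : ∀ {c c′ w w′} (O : Owner c w) (O′ : Owner c′ w′) → h c ≡ h c′ →
    Owner.point O ≡ Owner.point O′
  same-label⇒same-point {c} {c′} O O′ hc≡hc′ = inj₁-injective (trans (sym (Owner.s-piece O))
    (trans (h-≡⇒sj-≡ (Owner.piece O) c c′ hc≡hc′)
           (subst (λ l → ss l c′ ≡ inj₁ _) (same-label⇒same-owner O O′ hc≡hc′) (Owner.s-piece O′))))

  module _ (j : Piece) {t u : ℕ} (t∈ : t ∈ᵗ Tj j) (u∈ : u ∈ᵗ βᵢ₋₁ t)
           {c : Fin k} {w : ℕ} (O : Owner c w) (j≢J : j ≢ Owner.piece O) where
    private
      J = Owner.piece O
      z = Owner.point O

      ≢-across : ∀ {w′} → w′ ∈ᵗ Tj J → t ≢ w′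
      ≢-across w′∈ refl = Tj-disjoint j J j≢J t t∈ w′∈

      homogeneous : ∀ {w′ z′} → w′ ∈ᵗ Tj J → z′ ∈ᵗ βᵢ₋₁ w′ →
        (Trigraph.black Gᵢ₋₁ t w′ ≡ true → GE u z′ ≡ true)
        × (Trigraph.black Gᵢ₋₁ t w′ ≡ false → Trigraph.red Gᵢ₋₁ t w′ ≡ false → GE u z′ ≡ false)
      homogeneous {w′} {z′} w′∈ z′∈ = HomogeneousBags.homogeneous bagsᵢ₋₁ t w′
        (Tj⊆Vᵢ₋₁ j t t∈) (Tj⊆Vᵢ₋₁ J w′ w′∈) (≢-across w′∈) u z′ u∈ z′∈

    𝓔j-label⇒adj : 𝓔j j (inj₁ t) (inj₂ (h c)) ≡ true → GE u z ≡ true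
    𝓔j-label⇒adj e with to (𝓔j-spec j (inj₁ t) (inj₂ (h c))) e
    ... | inj₁ (inj₁ (_ , _ , hc∈)) = ⊥-elim (label-not-virtual-of-owner O j j≢J hc∈)
    ... | inj₁ (inj₂ (inj₂ (_ , _ , t≡h , _))) = ⊥-elim (inj₁≢inj₂ t≡h)
    ... | inj₂ (inj₁ (_ , hc∈ , _)) = ⊥-elim (label-not-virtual-of-owner O j j≢J hc∈)
    ... | inj₂ (inj₂ (inj₁ (_ , _ , t≡h , _))) = ⊥-elim (inj₁≢inj₂ t≡h)
    ... | inj₂ (inj₂ (inj₂ (_ , _ , _ , t≡h , _))) = ⊥-elim (inj₁≢inj₂ t≡h)
    ... | inj₁ (inj₂ (inj₁ (c′ , w′ , hc≡hc′ , _ , f′c′≡w′ , (w′∈D′ , _) , inj₁ 𝓔′≡true))) =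
      ⊥-elim (≡true⇒≢false 𝓔′≡true (𝓔′-no-real-edges t w′))
    ... | inj₁ (inj₂ (inj₁ (c′ , w′ , hc≡hc′ , _ , f′c′≡w′ , (w′∈D′ , _) , inj₂ (t′ , t≡t′ , black)))) =
      subst (λ q → GE u q ≡ true) (sym z≡z′) (proj₁ (homogeneous w′∈TJ (Owner.point∈bag O′)) black′)
      where
      black′ : Trigraph.black Gᵢ₋₁ t w′ ≡ true
      black′ = subst (λ q → Trigraph.black Gᵢ₋₁ q w′ ≡ true) (sym (inj₁-injective t≡t′)) black
      O′ = owner c′ w′ f′c′≡w′ w′∈D′
      z≡z′ = same-label⇒same-point O O′ (inj₂-injective hc≡hc′)
      w′∈TJ : w′ ∈ᵗ Tj J
      w′∈TJ = subst (λ l → w′ ∈ᵗ Tj l) (same-label⇒same-owner O O′ (inj₂-injective hc≡hc′)) (Owner.w∈T O′)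

    -- No red edge joins Tj j to D_J, so by homogeneity the G-edge u z forces a black edge t w.
    adj⇒𝓔j-label : GE u z ≡ true → 𝓔j j (inj₁ t) (inj₂ (h c)) ≡ true
    adj⇒𝓔j-label e = from (𝓔j-spec j (inj₁ t) (inj₂ (h c)))
      (inj₁ (inj₂ (inj₁ (c , w , refl , t∈ , Owner.f′≡w O , (Owner.w∈D′ O , w∉Dj) , inj₂ (t , refl , black)))))
      where
      w∉Dj : (w ∈ᵇ Dj j) ≡ false
      w∉Dj = ¬-not (λ w∈Dj → j≢J (Dj-owner-unique {w} j J w∈Dj (Owner.w∈D O)))
      black : Trigraph.black Gᵢ₋₁ t w ≡ true
      black with Trigraph.black Gᵢ₋₁ t w in black≡
      ... | true = refl
      ... | false = ⊥-elim (≡true⇒≢false e (proj₂ (homogeneous (Owner.w∈T O) (Owner.point∈bag O)) black≡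
                                               (no-red-to-other-D j J j≢J t w t∈ (Owner.w∈D O))))

    𝓔j-label : 𝓔j j (inj₁ t) (inj₂ (h c)) ≡ GE u z
    𝓔j-label = bool-ext 𝓔j-label⇒adj adj⇒𝓔j-label

  adj-real-virtual : ∀ j t u o → t ∈ᵗ Tj j → u ∈ᵗ βᵢ₋₁ t → o ∈ᵗ 𝒱π →
    adjGπ S i π (inj₁ u) (inj₂ o) ≡ adjGπ S (suc n) (πs j) (inj₁ u) (inj₂ o)
  adj-real-virtual j t u o t∈ u∈ o∈ = begin
    any (λ t′ → (u ∈ᵇ βᵢ t′) ∧ g t′) Tπ        ≡⟨ via-parent (∈Tπ′⁻ t (Tj⊆Tπ′ j t t∈)) ⟩
    𝓔′-sym (inj₁ t) (inj₂ o)                   ≡⟨ 𝓔j-real-virtual j t o t∈ o∈ ⟨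
    gj t                                       ≡⟨ bag-searchᵢ₋₁ j u t gj t∈ u∈ ⟨
    adjGπ S (suc n) (πs j) (inj₁ u) (inj₂ o)  ∎
    where
    open ≡-Reasoning
    g gj : ℕ → Bool
    g t′ = 𝓔π (inj₁ t′) (inj₂ o)
    gj t′ = 𝓔j j (inj₁ t′) (inj₂ o)
    via-parent : (t ≡ u₁ ⊎ t ≡ u₂) ⊎ (t ∈ᵗ Tπ × t ≢ v × t ≢ u₁ × t ≢ u₂) →
      any (λ t′ → (u ∈ᵇ βᵢ t′) ∧ g t′) Tπ ≡ 𝓔′-sym (inj₁ t) (inj₂ o)
    via-parent (inj₁ (inj₁ refl)) rewrite proj₁ (𝓔′-u₁ o) | proj₂ (𝓔′-u₁ o) | 𝓔π-sym (inj₂ o) (inj₁ v) =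
      trans (bag-searchᵢ u v g v∈Tπ (βᵢ₋₁u₁⊆βᵢv u u∈)) (sym (∨-idem _))
    via-parent (inj₁ (inj₂ refl)) rewrite proj₁ (𝓔′-u₂ o) | proj₂ (𝓔′-u₂ o) | 𝓔π-sym (inj₂ o) (inj₁ v) =
      trans (bag-searchᵢ u v g v∈Tπ (βᵢ₋₁u₂⊆βᵢv u u∈)) (sym (∨-idem _))
    via-parent (inj₂ (t∈Tπ , t≢v , t≢u₁ , t≢u₂))
      rewrite proj₁ (𝓔′-other t o t∈Tπ t≢v t≢u₁ t≢u₂ o∈) | proj₂ (𝓔′-other t o t∈Tπ t≢v t≢u₁ t≢u₂ o∈)
            | 𝓔π-sym (inj₂ o) (inj₁ t) =
      trans (bag-searchᵢ u t g t∈Tπ (βᵢ₋₁⊆βᵢ-other u t t≢v u∈)) (sym (∨-idem _))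

  adj-real-real : ∀ j a b → a ∈ᵗ βset S (suc n) (Tj j) → b ∈ᵗ βset S (suc n) (Tj j) →
    adjGπ S i π (inj₁ a) (inj₁ b) ≡ adjGπ S (suc n) (πs j) (inj₁ a) (inj₁ b)
  adj-real-real j a b a∈ b∈ rewrite a∈ | b∈ | βsetj⊆βsetᵢ j a a∈ | βsetj⊆βsetᵢ j b b∈ = refl

  adj-virtual-virtual : ∀ j o o′ → o ∈ᵗ 𝒱π → o′ ∈ᵗ 𝒱π →
    adjGπ S i π (inj₂ o) (inj₂ o′) ≡ adjGπ S (suc n) (πs j) (inj₂ o) (inj₂ o′)
  adj-virtual-virtual j o o′ o∈ o′∈
    rewrite 𝓔j-virtual-virtual j o o′ o∈ o′∈ | 𝓔′-virtual o o′ o∈ o′∈ | 𝓔′-virtual o′ o o′∈ o∈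
          | 𝓔π-sym (inj₂ o′) (inj₂ o) = sym (∨-idem _)

  sj-adj-at : ∀ j a b {p q} → ss j a ≡ p → ss j b ≡ q → adjGπ S (suc n) (πs j) p q ≡ LGraph.E H (h a) (h b)
  sj-adj-at j a b refl refl = sj-adj j a b

  s∈Gπ : ∀ a → inGπ S i π (s a) ≡ true
  s∈Gπ a with indexKind a
  ... | virtual o f′a≡o o∈ = subst (λ q → inGπ S i π q ≡ true) (sym (s-virtual a o f′a≡o o∈)) o∈
  ... | real O = subst (λ q → inGπ S i π q ≡ true) (sym (s-point O)) (Owner.point∈βsetᵢ O)

  s-respects-virtual : ∀ a o → fπ a ≡ inj₂ o → s a ≡ inj₂ o
  s-respects-virtual a o fπa≡o =
    s-virtual a o (f′-agrees fπa≡o λ ()) (subst (λ q → inTV Dπ 𝒱π q ≡ true) fπa≡o (fπ-range a))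

  owned-point-in : ∀ a {w u} → f′ a ≡ inj₁ w → w ∈ᵗ Tπ′ → (∀ z → z ∈ᵗ βᵢ₋₁ w → z ∈ᵗ βᵢ u) →
    Σ ℕ (λ z → s a ≡ inj₁ z × z ∈ᵗ βᵢ u)
  owned-point-in a {w} f′a≡w w∈ ⊆ = Owner.point O , s-point O , ⊆ (Owner.point O) (Owner.point∈bag O)
    where O = owner a w f′a≡w (Dπ′-intro a w∈ f′a≡w)

  s-respects-bags : ∀ a u → fπ a ≡ inj₁ u → Σ ℕ (λ z → s a ≡ inj₁ z × z ∈ᵗ βᵢ u)
  s-respects-bags a u fπa≡u with u ≟ v
  ... | yes refl with proj₁ (f′-compatible a) fπa≡u
  ...   | inj₁ f′a≡u₁ = owned-point-in a f′a≡u₁ u₁∈Tπ′ βᵢ₋₁u₁⊆βᵢv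
  ...   | inj₂ f′a≡u₂ = owned-point-in a f′a≡u₂ u₂∈Tπ′ βᵢ₋₁u₂⊆βᵢv
  s-respects-bags a u fπa≡u | no u≢v =
    owned-point-in a (f′-agrees fπa≡u (u≢v ∘ inj₁-injective)) (Tπ-other⊆Tπ′ (Dπ⊆Tπ u u∈Dπ) u≢v)
                   (λ z → βᵢ₋₁⊆βᵢ-other z u u≢v)
    where u∈Dπ = subst (λ q → inTV Dπ 𝒱π q ≡ true) fπa≡u (fπ-range a)

  distinct-owners⇒distinct-points : ∀ {a b w w′} (O : Owner a w) (O′ : Owner b w′) →
    Owner.piece O ≢ Owner.piece O′ → Owner.point O ≢ Owner.point O′
  distinct-owners⇒distinct-points {w = w} {w′} O O′ J≢J′ z≡z′ =
    HomogeneousBags.disjoint bagsᵢ₋₁ w w′ (Tj⊆Vᵢ₋₁ _ w (Owner.w∈T O)) (Tj⊆Vᵢ₋₁ _ w′ (Owner.w∈T O′)) w≢w′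
      (Owner.point O) (Owner.point∈bag O) (subst (_∈ᵗ βᵢ₋₁ w′) (sym z≡z′) (Owner.point∈bag O′))
    where
    w≢w′ : w ≢ w′
    w≢w′ refl = Tj-disjoint _ _ J≢J′ w (Owner.w∈T O) (Owner.w∈T O′)

  s-≡⇒h-≡-owned : ∀ a b {w w′} (O : Owner a w) (O′ : Owner b w′) → s a ≡ s b → h a ≡ h b
  s-≡⇒h-≡-owned a b O O′ sa≡sb with Owner.piece O Fin.≟ Owner.piece O′
  ... | yes J≡J′ = sj-≡⇒h-≡ (Owner.piece O) a b
    (trans (sym (s-owned O)) (trans sa≡sb (trans (s-owned O′) (cong (λ l → ss l b) (sym J≡J′)))))
  ... | no J≢J′ = ⊥-elim (distinct-owners⇒distinct-points O O′ J≢J′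
    (inj₁-injective (trans (sym (s-point O)) (trans sa≡sb (s-point O′)))))

  s-≡⇒h-≡ : ∀ a b → s a ≡ s b → h a ≡ h b
  s-≡⇒h-≡ a b sa≡sb with indexKind a | indexKind b
  ... | virtual o f′a≡o o∈ | virtual o′ f′b≡o′ o′∈ = sj-≡⇒h-≡ Fin.zero a b
    (trans (sj≡s-virtual a o f′a≡o o∈ Fin.zero) (trans sa≡sb (sym (sj≡s-virtual b o′ f′b≡o′ o′∈ Fin.zero))))
  ... | real O | virtual o′ f′b≡o′ o′∈ =
    ⊥-elim (inj₁≢inj₂ (trans (sym (s-point O)) (trans sa≡sb (s-virtual b o′ f′b≡o′ o′∈))))
  ... | virtual o f′a≡o o∈ | real O′ =
    ⊥-elim (inj₁≢inj₂ (trans (sym (s-point O′)) (trans (sym sa≡sb) (s-virtual a o f′a≡o o∈))))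
  ... | real O | real O′ = s-≡⇒h-≡-owned a b O O′ sa≡sb

  h-≡⇒s-≡-owned : ∀ {a w} (O : Owner a w) b → h a ≡ h b → s a ≡ s b
  h-≡⇒s-≡-owned {a} O b ha≡hb with indexKind b
  ... | virtual o′ f′b≡o′ o′∈ = ⊥-elim (inj₁≢inj₂ (trans (sym (Owner.s-piece O))
          (trans (h-≡⇒sj-≡ (Owner.piece O) a b ha≡hb) (sj-virtual-index b o′ f′b≡o′ o′∈ (Owner.piece O)))))
  ... | real O′ = trans (s-point O) (trans (cong inj₁ (same-label⇒same-point O O′ ha≡hb)) (sym (s-point O′)))

  h-≡⇒s-≡ : ∀ a b → h a ≡ h b → s a ≡ s b
  h-≡⇒s-≡ a b ha≡hb with indexKind a | indexKind b
  ... | real O | _ = h-≡⇒s-≡-owned O b ha≡hb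
  ... | virtual _ _ _ | real O′ = sym (h-≡⇒s-≡-owned O′ a (sym ha≡hb))
  ... | virtual o f′a≡o o∈ | virtual o′ f′b≡o′ o′∈ =
    trans (sym (sj≡s-virtual a o f′a≡o o∈ Fin.zero))
          (trans (h-≡⇒sj-≡ Fin.zero a b ha≡hb) (sj≡s-virtual b o′ f′b≡o′ o′∈ Fin.zero))

  adjᵢ-real-real : ∀ {z z′} → z ∈ᵗ βset S i Tπ → z′ ∈ᵗ βset S i Tπ → adjGπ S i π (inj₁ z) (inj₁ z′) ≡ GE z z′
  adjᵢ-real-real z∈ z′∈ rewrite z∈ | z′∈ = refl

  s-adj-owned : ∀ a b {w w′} (O : Owner a w) (O′ : Owner b w′) →
    adjGπ S i π (inj₁ (Owner.point O)) (inj₁ (Owner.point O′)) ≡ LGraph.E H (h a) (h b)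
  s-adj-owned a b {w} O O′ with Owner.piece O′ Fin.≟ Owner.piece O
  ... | yes J′≡J = trans
    (adj-real-real J z z′ (Owner.point∈βset O) (subst (λ l → z′ ∈ᵗ βset S (suc n) (Tj l)) J′≡J (Owner.point∈βset O′)))
    (sj-adj-at J a b (Owner.s-piece O) (subst (λ l → ss l b ≡ inj₁ z′) J′≡J (Owner.s-piece O′)))
    where
    J = Owner.piece O
    z = Owner.point O
    z′ = Owner.point O′
  ... | no J′≢J = begin
    adjGπ S i π (inj₁ z) (inj₁ z′)                ≡⟨ adjᵢ-real-real (Owner.point∈βsetᵢ O) (Owner.point∈βsetᵢ O′) ⟩
    GE z z′                                       ≡⟨ 𝓔j-label J w∈T z∈ O′ J≢J′ ⟨
    gJ w                                          ≡⟨ bag-searchᵢ₋₁ J z w gJ w∈T z∈ ⟨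
    adjGπ S (suc n) (πs J) (inj₁ z) (inj₂ (h b))  ≡⟨ sj-adj-at J a b (Owner.s-piece O) (Owner.s-elsewhere O′ J J≢J′) ⟩
    LGraph.E H (h a) (h b)                        ∎
    where
    open ≡-Reasoning
    J = Owner.piece O
    z = Owner.point O
    z′ = Owner.point O′
    w∈T = Owner.w∈T O
    z∈ = Owner.point∈bag O
    J≢J′ : J ≢ Owner.piece O′
    J≢J′ = J′≢J ∘ sym
    gJ : ℕ → Bool
    gJ t = 𝓔j J (inj₁ t) (inj₂ (h b))

  s-adj : ∀ a b → adjGπ S i π (s a) (s b) ≡ LGraph.E H (h a) (h b)
  s-adj a b with indexKind a | indexKind b
  ... | virtual o f′a≡o o∈ | virtual o′ f′b≡o′ o′∈
    rewrite s-virtual a o f′a≡o o∈ | s-virtual b o′ f′b≡o′ o′∈ =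
      trans (adj-virtual-virtual Fin.zero o o′ o∈ o′∈)
            (sj-adj-at Fin.zero a b (sj-virtual-index a o f′a≡o o∈ Fin.zero)
                                    (sj-virtual-index b o′ f′b≡o′ o′∈ Fin.zero))
  ... | real {w} O | virtual o′ f′b≡o′ o′∈ rewrite s-point O | s-virtual b o′ f′b≡o′ o′∈ =
    trans (adj-real-virtual J w (Owner.point O) o′ (Owner.w∈T O) (Owner.point∈bag O) o′∈)
          (sj-adj-at J a b (Owner.s-piece O) (sj-virtual-index b o′ f′b≡o′ o′∈ J))
    where J = Owner.piece O
  ... | virtual o f′a≡o o∈ | real {w′} O′ rewrite s-virtual a o f′a≡o o∈ | s-point O′ =
    trans (adj-real-virtual J′ w′ (Owner.point O′) o (Owner.w∈T O′) (Owner.point∈bag O′) o∈)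
          (sj-adj-at J′ a b (sj-virtual-index a o f′a≡o o∈ J′) (Owner.s-piece O′))
    where J′ = Owner.piece O′
  ... | real O | real O′ rewrite s-point O | s-point O′ = s-adj-owned a b O O′

  s-solution : Solution S i H π s
  s-solution = s∈Gπ , s-respects-virtual , s-respects-bags , s-≡⇒h-≡ , h-≡⇒s-≡ , s-adj

  module AtVertex (j : Piece) {t u : ℕ} (t∈ : t ∈ᵗ Tj j) (u∈ : u ∈ᵗ βᵢ₋₁ t) where

    u∈βset : u ∈ᵗ βset S (suc n) (Tj j)
    u∈βset = ∈βset⁺ S (suc n) (Tj j) t t∈ u u∈

    u∈βsetᵢ : u ∈ᵗ βset S i Tπ
    u∈βsetᵢ = βᵢ₋₁⊆βsetᵢ t (Tj⊆Tπ′ j t t∈) u u∈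

    s≡u⇔sj≡u : ∀ a → (s a ≡ inj₁ u → ss j a ≡ inj₁ u) × (ss j a ≡ inj₁ u → s a ≡ inj₁ u)
    s≡u⇔sj≡u a with indexKind a
    ... | virtual o f′a≡o o∈ = trans (sj≡s-virtual a o f′a≡o o∈ j) , trans (sym (sj≡s-virtual a o f′a≡o o∈ j))
    ... | real {w} O with Owner.piece O Fin.≟ j
    ...   | yes refl = trans (sym (s-owned O)) , trans (s-owned O)
    ...   | no J≢j = (λ sa≡u → ⊥-elim (point≢u (inj₁-injective (trans (sym (s-point O)) sa≡u))))
                   , (λ sja≡u → ⊥-elim (inj₁≢inj₂ (trans (sym sja≡u) (Owner.s-elsewhere O j (J≢j ∘ sym)))))
      where
      w≢t : w ≢ t
      w≢t refl = Tj-disjoint _ j J≢j w (Owner.w∈T O) t∈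
      point≢u : Owner.point O ≢ u
      point≢u refl = HomogeneousBags.disjoint bagsᵢ₋₁ w t (Tj⊆Vᵢ₋₁ _ w (Owner.w∈T O)) (Tj⊆Vᵢ₋₁ j t t∈) w≢t
                       u (Owner.point∈bag O) u∈

    adj-with-u : ∀ a → (adjGπ S i π (s a) (inj₁ u) ≡ adjGπ S (suc n) (πs j) (ss j a) (inj₁ u))
                     × (adjGπ S i π (inj₁ u) (s a) ≡ adjGπ S (suc n) (πs j) (inj₁ u) (ss j a))
    adj-with-u a with indexKind a
    ... | virtual o f′a≡o o∈ rewrite s-virtual a o f′a≡o o∈ | sj-virtual-index a o f′a≡o o∈ j =
      adj-real-virtual j t u o t∈ u∈ o∈ , adj-real-virtual j t u o t∈ u∈ o∈
    ... | real O with Owner.piece O Fin.≟ j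
    ...   | yes refl rewrite s-point O | Owner.s-piece O =
      adj-real-real j _ u (Owner.point∈βset O) u∈βset , adj-real-real j u _ u∈βset (Owner.point∈βset O)
    ...   | no J≢j rewrite s-point O | Owner.s-elsewhere O j (J≢j ∘ sym) =
      trans (adjᵢ-real-real (Owner.point∈βsetᵢ O) u∈βsetᵢ) (trans (GE-sym (Owner.point O) u) to-piece)
      , trans (adjᵢ-real-real u∈βsetᵢ (Owner.point∈βsetᵢ O)) to-piece
      where
      to-piece : GE u (Owner.point O) ≡ adjGπ S (suc n) (πs j) (inj₁ u) (inj₂ (h a))
      to-piece = sym (trans (bag-searchᵢ₋₁ j u t (λ t′ → 𝓔j j (inj₁ t′) (inj₂ (h a))) t∈ u∈)
                            (𝓔j-label j t∈ u∈ O (J≢j ∘ sym)))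

    ρ ρj : Var k → Node
    ρ = env s (inj₁ u)
    ρj = env (ss j) (inj₁ u)

    same-equalities : ∀ A B → eqN (ρ A) (ρ B) ≡ eqN (ρj A) (ρj B)
    same-equalities (x a) (x b) =
      eqN-cong (λ e → h-≡⇒sj-≡ j a b (s-≡⇒h-≡ a b e)) (λ e → h-≡⇒s-≡ a b (sj-≡⇒h-≡ j a b e))
    same-equalities (x a) y = eqN-cong (proj₁ (s≡u⇔sj≡u a)) (proj₂ (s≡u⇔sj≡u a))
    same-equalities y (x b) =
      eqN-cong (λ e → sym (proj₁ (s≡u⇔sj≡u b) (sym e))) (λ e → sym (proj₂ (s≡u⇔sj≡u b) (sym e)))
    same-equalities y y = refl

    same-adjacencies : ∀ A B → adjGπ S i π (ρ A) (ρ B) ≡ adjGπ S (suc n) (πs j) (ρj A) (ρj B)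
    same-adjacencies (x a) (x b) = trans (s-adj a b) (sym (sj-adj j a b))
    same-adjacencies (x a) y = proj₁ (adj-with-u a)
    same-adjacencies y (x b) = proj₂ (adj-with-u b)
    same-adjacencies y y = adj-real-real j u u u∈βset u∈βset

    evalQF-agrees : ∀ φ → evalQF (adjGπ S i π) ρ φ ≡ evalQF (adjGπ S (suc n) (πs j)) ρj φ
    evalQF-agrees = evalQF-cong (adjGπ S i π) (adjGπ S (suc n) (πs j)) ρ ρj same-equalities same-adjacencies

  Tπ≈v∷rest : ∀ {t} → t ∈ Tπ ⇔ t ∈ v ∷ rm-v Tπ
  Tπ≈v∷rest {t} = mk⇔ to′ from′
    where
    to′ : t ∈ Tπ → t ∈ v ∷ rm-v Tπ
    to′ t∈ with t ≟ v
    ... | yes refl = here refl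
    ... | no t≢v = there (∈-rm-v⁺ t∈ t≢v)
    from′ : t ∈ v ∷ rm-v Tπ → t ∈ Tπ
    from′ (here refl) = ∈ᵗ⇒∈ v Tπ v∈Tπ
    from′ (there t∈) = proj₁ (∈-rm-v⁻ {L = Tπ} t∈)

  v∷rest-unique : Unique (v ∷ rm-v Tπ)
  v∷rest-unique = All.tabulate (λ t∈ v≡t → proj₂ (∈-rm-v⁻ {L = Tπ} t∈) (sym v≡t)) ∷ Unique.filter⁺ _ Tπ-unique

  pieces : List ℕ
  pieces = concatMap Tj (allFin (suc m))

  pieces-unique : Unique pieces
  pieces-unique = unique-concatMap Tj (Unique.allFin⁺ (suc m)) Tj-unique
    (λ j≢l {t} (t∈j , t∈l) → Tj-disjoint _ _ j≢l t (∈⇒∈ᵗ t∈j) (∈⇒∈ᵗ t∈l))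

  Tπ′≈pieces : ∀ {t} → t ∈ Tπ′ ⇔ t ∈ pieces
  Tπ′≈pieces {t} = mk⇔ to′ from′
    where
    to′ : t ∈ Tπ′ → t ∈ pieces
    to′ t∈ with to (Tπ′-covered t) (∈⇒∈ᵗ t∈)
    ... | j , t∈j = ∈-concatMap⁺ Tj (lose (∈-allFin j) (∈ᵗ⇒∈ t (Tj j) t∈j))
    from′ : t ∈ pieces → t ∈ Tπ′
    from′ t∈ with find (∈-concatMap⁻ Tj {xs = allFin (suc m)} t∈)
    ... | j , _ , t∈j = ∈ᵗ⇒∈ t Tπ′ (from (Tπ′-covered t) (j , ∈⇒∈ᵗ t∈j))

  countᵇ-βset-split : ∀ (P : ℕ → Bool) →
    countᵇ P (βset S i Tπ) ≡ sum (map (λ j → countᵇ P (βset S (suc n) (Tj j))) (allFin (suc m)))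
  countᵇ-βset-split P = begin
    countᵇ P (βset S i Tπ)                        ≡⟨ countᵇ-concatMap P βᵢ Tπ ⟩
    sum (map gᵢ Tπ)                               ≡⟨ sum-map-unique-set gᵢ Tπ-unique v∷rest-unique Tπ≈v∷rest ⟩
    gᵢ v + sum (map gᵢ (rm-v Tπ))                 ≡⟨ cong₂ _+_ gᵢ-v gᵢ-rest ⟩
    (g u₁ + g u₂) + sum (map g (rm-v Tπ))         ≡⟨ +-assoc (g u₁) (g u₂) _ ⟩
    sum (map g Tπ′)                               ≡⟨ sum-map-unique-set g Tπ′-unique pieces-unique Tπ′≈pieces ⟩
    sum (map g pieces)                            ≡⟨ sum-map-concatMap g Tj (allFin (suc m)) ⟩
    sum (map (λ j → sum (map g (Tj j))) (allFin (suc m)))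
      ≡⟨ sum-map-cong-local _ _ (allFin (suc m)) (λ j _ → sym (countᵇ-concatMap P βᵢ₋₁ (Tj j))) ⟩
    sum (map (λ j → countᵇ P (βset S (suc n) (Tj j))) (allFin (suc m))) ∎
    where
    open ≡-Reasoning
    gᵢ g : ℕ → ℕ
    gᵢ t = countᵇ P (βᵢ t)
    g t = countᵇ P (βᵢ₋₁ t)
    gᵢ-v : gᵢ v ≡ g u₁ + g u₂
    gᵢ-v = trans (cong (countᵇ P) βᵢ-v) (countᵇ-++ P (βᵢ₋₁ u₁) (βᵢ₋₁ u₂))
    gᵢ-rest : sum (map gᵢ (rm-v Tπ)) ≡ sum (map g (rm-v Tπ))
    gᵢ-rest = sum-map-cong-local gᵢ g (rm-v Tπ) (λ t t∈ → cong (countᵇ P) (βᵢ-other (proj₂ (∈-rm-v⁻ {L = Tπ} t∈))))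

  satisfiesᵢ : Fin p → ℕ → Bool
  satisfiesᵢ α u = evalQF (adjGπ S i π) (env s (inj₁ u)) (ψ α)

  satisfiesⱼ : Piece → Fin p → ℕ → Bool
  satisfiesⱼ j α u = evalQF (adjGπ S (suc n) (πs j)) (env (ss j) (inj₁ u)) (ψ α)

  count-agrees : ∀ j α →
    countᵇ (satisfiesᵢ α) (βset S (suc n) (Tj j)) ≡ countᵇ (satisfiesⱼ j α) (βset S (suc n) (Tj j))
  count-agrees j α = countᵇ-cong-local (satisfiesᵢ α) (satisfiesⱼ j α) (βset S (suc n) (Tj j)) λ u u∈ →
    let (t , t∈ , u∈t) = ∈βset⁻ S (suc n) (Tj j) u (∈⇒∈ᵗ u∈) in AtVertex.evalQF-agrees j t∈ u∈t (ψ α)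

  s-value : value S i ψ π s ≡ sum (map (λ j → value S (suc n) ψ (πs j) (ss j)) (allFin (suc m)))
  s-value = begin
    sum (map (λ α → countᵇ (satisfiesᵢ α) (βset S i Tπ)) (allFin p))
      ≡⟨ sum-map-cong-local _ _ (allFin p) (λ α _ → trans (countᵇ-βset-split (satisfiesᵢ α))
           (sum-map-cong-local _ _ (allFin (suc m)) (λ j _ → count-agrees j α))) ⟩
    sum (map (λ α → sum (map (λ j → countᵇ (satisfiesⱼ j α) (βset S (suc n) (Tj j))) (allFin (suc m)))) (allFin p))
      ≡⟨ sum-map-swap (λ j α → countᵇ (satisfiesⱼ j α) (βset S (suc n) (Tj j))) (allFin p) (allFin (suc m)) ⟩
    sum (map (λ j → value S (suc n) ψ (πs j) (ss j)) (allFin (suc m))) ∎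
    where open ≡-Reasoning

lemma4p6 : (G : Graph) (S : ContrSeq G) (d : ℕ) → HasWidth S d →
    (k p : ℕ) (ψ : Fin p → QF k) →
    (i : ℕ) → 2 ≤ i → i ≤ lenSeq S →
    (u1 u2 v : ℕ) → stepAt S i ≡ just (u1 , u2 , v) →
    (H : LGraph k) (π : VData k) → IsVirtualProfile S k d i H π →
    (f' : Fin k → Node) → Compatible π u1 u2 v f' →
    (m : ℕ) (πs : Fin (suc m) → VData k) → FDecomp S k d i H π u1 u2 v f' (suc m) πs →
    (ss : Fin (suc m) → Fin k → Node) → (∀ j → Solution S (i ∸ 1) H (πs j) (ss j)) →
    Solution S i H π (bigOplus m πs ss)
    × value S i ψ π (bigOplus m πs ss)
      ≡ sum (map (λ j → value S (i ∸ 1) ψ (πs j) (ss j)) (allFin (suc m)))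
lemma4p6 G S d _ k p ψ zero () _
lemma4p6 G S d _ k p ψ (suc zero) (s≤s ()) _
lemma4p6 G S d _ k p ψ (suc (suc n)) _ _ u1 u2 v at-i H π vπ f' compatible m πs decomposition ss sols =
  s-solution , s-value
  where open Decomposition G S d k p ψ n u1 u2 v at-i H π vπ f' compatible m πs decomposition ss sols
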